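{- Let $n\geq 4$ and $0\le p\le 1$. In the $n$-dimensional bubble-sort network $B_n$ under the random node fault model in which each node is fault-free independently with probability $p$, $$P(1,3,0)=P(0,3,1)=P(0,1,3)=\tfrac{1}{6}(n^8-7n^7+21n^6-35n^5+34n^4-18n^3+4n^2)p^{4(n-2)!}+\tfrac{1}{2}(n^7-7n^6+21n^5-35n^4+34n^3-18n^2+4n)p^{4(n-2)!-(n-3)!}+\tfrac{1}{2}(n^6-8n^5+25n^4-40n^3+34n^2-12n)p^{4(n-2)!-2(n-3)!}+\tfrac{1}{6}(n^5-10n^4+35n^3-50n^2+24n)p^{4(n-2)!-3(n-3)!}.$$
   Context: Let $N_n=\{1,\dots,n\}$. The bubble-sort network $B_n$ has as vertices the permutations of $N_n$, written as strings $u_1u_2\cdots u_n$, two permutations being adjacent iff they differ by swapping two adjacent positions $u_i,u_{i+1}$. For distinct $a_1,a_2\in N_n$, a $B_{n-2}$-subnetwork of $B_n$ is one of the following vertex sets (each inducing a copy of $B_{n-2}$ and having $(n-2)!$ vertices): $a_1a_2X^{n-2}$, the set of permutations with $u_1=a_1,u_2=a_2$ ("prefix form"); $a_1X^{n-2}a_2$, the set with $u_1=a_1,u_n=a_2$ ("middle form"); $X^{n-2}a_1a_2$, the set with $u_{n-1}=a_1,u_n=a_2$ ("suffix form"). Each form gives $n(n-1)$ subnetworks. In the random node fault model each vertex is fault-free independently with probability $p$ (faulty with probability $1-p$); a subnetwork is fault-free if all its vertices are. For nonnegative integers $i,j,k$ with $i+j+k=4$, $P(i,j,k)$ denotes the sum,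 over all sets $S$ of four distinct $B_{n-2}$-subnetworks consisting of $i$ of prefix form, $j$ of middle form and $k$ of suffix form, of the probability that all four members of $S$ are fault-free, i.e. of $p^{|\bigcup_{H\in S}H|}$. (The paper calls $P(i,j,k)$ "the probability that there are four fault-free $B_{n-2}$'s, $i$ of which are of prefix form, $j$ of middle form and $k$ of suffix form".)
   Formalization: The fault-free probability p takes only rational values with $0\le p\le 1$. -}

module Defs where

open import Data.Bool using (Bool; true; false; _∧_; _∨_; not; if_then_else_)
open import Data.Nat as ℕ using (ℕ; zero; suc; _∸_; _!)
open import Data.Fin as Fin using (Fin)
open import Data.Fin.Properties as FinP using ()
open import Data.List using (List; []; _∷_; _++_; map; concatMap; take; reverse; foldr; length)
open import Data.Bool.ListAction using (any)
open import Data.List.Properties using (≡-dec)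
open import Data.Integer using (+_)
open import Data.Rational using (ℚ; 1ℚ; 0ℚ; _*_; _+_)
open import Data.Product using (_×_; _,_)
open import Relation.Nullary.Decidable using (⌊_⌋)
open import Relation.Binary.PropositionalEquality using (_≡_)

ℕtoℚ : ℕ → ℚ
ℕtoℚ m = + m Data.Rational./ 1

infixr 8 _^ℚ_
_^ℚ_ : ℚ → ℕ → ℚ
p ^ℚ zero  = 1ℚ
p ^ℚ suc m = p * (p ^ℚ m)

allFin : (n : ℕ) → List (Fin n)
allFin n = Data.List.allFin n

words : (n m : ℕ) → List (List (Fin n))
words n zero    = [] ∷ []
words n (suc m) = concatMap (λ a → map (a ∷_) (words n m)) (allFin n)

eqFin : {n : ℕ} → Fin n → Fin n → Bool
eqFin a b = ⌊ a Fin.≟ b ⌋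

eqWord : {n : ℕ} → List (Fin n) → List (Fin n) → Bool
eqWord u v = ⌊ ≡-dec Fin._≟_ u v ⌋

elemB : {n : ℕ} → Fin n → List (Fin n) → Bool
elemB a []       = false
elemB a (b ∷ bs) = eqFin a b ∨ elemB a bs

distinctB : {n : ℕ} → List (Fin n) → Bool
distinctB []       = true
distinctB (a ∷ as) = not (elemB a as) ∧ distinctB as

-- vertices of B_n: the permutations u₁u₂⋯uₙ of the n symbols (here Fin n),
-- i.e. the length-n words with pairwise distinct letters
vertices : (n : ℕ) → List (List (Fin n))
vertices n = Data.List.filterᵇ distinctB (words n n)

data Form : Set where
  prefix middle suffix : Form

-- a B_{n-2}-subnetwork: a form together with distinct a₁, a₂
Sub : ℕ → Set
Sub n = Form × Fin n × Fin n

allSubs : (n : ℕ) → List (Sub n)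
allSubs n =
  concatMap (λ f → concatMap (λ a₁ →
    concatMap (λ a₂ → if eqFin a₁ a₂ then [] else ((f , a₁ , a₂) ∷ [])) (allFin n))
    (allFin n)) (prefix ∷ middle ∷ suffix ∷ [])

inSub : {n : ℕ} → Sub n → List (Fin n) → Bool
inSub (prefix , a₁ , a₂) u = eqWord (take 2 u) (a₁ ∷ a₂ ∷ [])
inSub (middle , a₁ , a₂) u = eqWord (take 1 u) (a₁ ∷ []) ∧ eqWord (take 1 (reverse u)) (a₂ ∷ [])
inSub (suffix , a₁ , a₂) u = eqWord (take 2 (reverse u)) (a₂ ∷ a₁ ∷ [])

countB : {A : Set} → (A → Bool) → List A → ℕ
countB P []       = 0
countB P (x ∷ xs) = if P x then suc (countB P xs) else countB P xs

unionSize : {n : ℕ} → List (Sub n) → ℕ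
unionSize {n} S = countB (λ u → any (λ H → inSub H u) S) (vertices n)

-- all k-element sublists (subsets, as the list has no duplicates)
choose : {A : Set} → ℕ → List A → List (List A)
choose zero    xs       = [] ∷ []
choose (suc k) []       = []
choose (suc k) (x ∷ xs) = map (x ∷_) (choose k xs) ++ choose (suc k) xs

formIs : Form → Form → Bool
formIs prefix prefix = true
formIs middle middle = true
formIs suffix suffix = true
formIs _      _      = false

countForm : {n : ℕ} → Form → List (Sub n) → ℕ
countForm f S = countB (λ { (g , _ , _) → formIs f g }) S

hasType : {n : ℕ} → ℕ → ℕ → ℕ → List (Sub n) → Bool
hasType i j k S =
  (countForm prefix S ℕ.≡ᵇ i) ∧ (countForm middle S ℕ.≡ᵇ j) ∧ (countForm suffix S ℕ.≡ᵇ k)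

sumℚ : List ℚ → ℚ
sumℚ = foldr _+_ 0ℚ

Pijk : (n : ℕ) → ℚ → ℕ → ℕ → ℕ → ℚ
Pijk n p i j k =
  sumℚ (map (λ S → p ^ℚ unionSize S) (Data.List.filterᵇ (hasType i j k) (choose 4 (allSubs n))))

-- Every B_{n-2} consists of the permutations with two prescribed letters in two prescribed
-- positions, so it has (n-2)! vertices. Distinct subnetworks of middle form (or of suffix form)
-- are disjoint, while a prefix a₁a₂X and a middle b₁Xb₂ share (n-3)! vertices if b₁ = a₁ and
-- b₂ ≠ a₂ and none otherwise, and similarly for a middle and a suffix. In each of the three
-- types, the member x of the form that occurs once is the only one that can meet the others, so
-- |⋃S| = 4(n-2)! - t(n-3)! where t is the number of the other three that meet x. For every x
-- exactly n-2 of the n(n-1) subnetworks of the other form meet it, hence each type sums to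
-- n(n-1) Σₜ C(n-2,t) C(n(n-1)-(n-2),3-t) p^(4(n-2)! - t(n-3)!), and expanding the binomial
-- coefficients gives the stated polynomials.

module Submission where

open import Defs
open import Data.Nat using (ℕ)
open import Data.Bool using (Bool; true; false; _∧_; _∨_; not; if_then_else_; T)
import Data.Bool.Properties as Boolₚ
open import Data.Empty using (⊥; ⊥-elim)
open import Data.Fin as Fin using (Fin)
import Data.Fin.Properties as Finₚ
open import Data.List using (List; []; _∷_; _++_; map; concatMap; take; reverse; length; tabulate; filterᵇ)
import Data.List.Properties as Listₚ
open import Data.List.Relation.Unary.All as All using (All; []; _∷_)
import Data.List.Relation.Unary.All.Properties as Allₚ
open import Data.List.Relation.Binary.Sublist.Propositional using (_⊆_; []; _∷_; _∷ʳ_; minimum)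
open import Data.List.Relation.Binary.Sublist.Propositional.Properties using (All-resp-⊆)
open import Data.List.Relation.Unary.AllPairs using (AllPairs; []; _∷_)
import Data.List.Relation.Unary.AllPairs.Properties as AllPairsₚ
open import Data.Product using (_×_; _,_; proj₁; proj₂)
open import Relation.Binary.PropositionalEquality
open import Relation.Nullary using (¬_; yes; no)
open import Relation.Nullary.Decidable using (isYes≗does; dec-true; dec-false)

module _ {n : ℕ} where

  eqFin-refl : (a : Fin n) → eqFin a a ≡ true
  eqFin-refl a = trans (isYes≗does (a Fin.≟ a)) (dec-true (a Fin.≟ a) refl)

  eqFin-false : {a b : Fin n} → ¬ a ≡ b → eqFin a b ≡ false
  eqFin-false {a} {b} a≢b = trans (isYes≗does (a Fin.≟ b)) (dec-false (a Fin.≟ b) a≢b)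

  eqFin-sym : (a b : Fin n) → eqFin a b ≡ eqFin b a
  eqFin-sym a b with a Fin.≟ b | b Fin.≟ a
  ... | yes _   | yes _   = refl
  ... | no _    | no _    = refl
  ... | yes a≡b | no b≢a  = ⊥-elim (b≢a (sym a≡b))
  ... | no a≢b  | yes b≡a = ⊥-elim (a≢b (sym b≡a))

  eqWord-∷ : (a b : Fin n) (x y : List (Fin n)) → eqWord (a ∷ x) (b ∷ y) ≡ eqFin a b ∧ eqWord x y
  eqWord-∷ a b x y with a Fin.≟ b | Listₚ.≡-dec Fin._≟_ x y
  ... | yes _ | yes _ = refl
  ... | yes _ | no _  = refl
  ... | no _  | yes _ = refl
  ... | no _  | no _  = refl

  eqWord-refl : (x : List (Fin n)) → eqWord x x ≡ true
  eqWord-refl x = trans (isYes≗does (Listₚ.≡-dec Fin._≟_ x x)) (dec-true (Listₚ.≡-dec Fin._≟_ x x) refl)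

  eqWord-false : {x y : List (Fin n)} → ¬ x ≡ y → eqWord x y ≡ false
  eqWord-false {x} {y} x≢y = trans (isYes≗does (Listₚ.≡-dec Fin._≟_ x y)) (dec-false (Listₚ.≡-dec Fin._≟_ x y) x≢y)

  eqWord-sound : {x y : List (Fin n)} → eqWord x y ≡ true → x ≡ y
  eqWord-sound {x} {y} e with Listₚ.≡-dec Fin._≟_ x y
  ... | yes x≡y = x≡y

  eqWord-reverse : (u w : List (Fin n)) → eqWord (reverse u) (reverse w) ≡ eqWord u w
  eqWord-reverse u w with Listₚ.≡-dec Fin._≟_ u w
  ... | yes refl = eqWord-refl (reverse u)
  ... | no u≢w   = eqWord-false (λ e → u≢w (Listₚ.reverse-injective e))

module _ where

  open import Data.Nat
  open import Data.Nat.Properties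
  open import Data.Nat.ListAction using (sum)
  open import Data.Nat.Tactic.RingSolver using (solve-∀)
  open import Algebra.Solver.IdempotentCommutativeMonoid Boolₚ.∧-idempotentCommutativeMonoid
    using (solve; _⊕_; _⊜_)
  import Algebra.Solver.IdempotentCommutativeMonoid Boolₚ.∨-idempotentCommutativeMonoid as ∨-Solver

  module _ {A : Set} where

    countB-++ : (P : A → Bool) (xs ys : List A) → countB P (xs ++ ys) ≡ countB P xs + countB P ys
    countB-++ P []       ys = refl
    countB-++ P (x ∷ xs) ys with P x
    ... | true  = cong suc (countB-++ P xs ys)
    ... | false = countB-++ P xs ys

    countB-cong-All : {P Q : A → Bool} (xs : List A) → All (λ x → P x ≡ Q x) xs → countB P xs ≡ countB Q xs
    countB-cong-All []       []                    = refl
    countB-cong-All {Q = Q} (x ∷ xs) (Px≡Qx ∷ es) rewrite Px≡Qx with Q x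
    ... | true  = cong suc (countB-cong-All xs es)
    ... | false = countB-cong-All xs es

    countB-cong : {P Q : A → Bool} (xs : List A) → (∀ x → P x ≡ Q x) → countB P xs ≡ countB Q xs
    countB-cong xs P≗Q = countB-cong-All xs (All.tabulate (λ {x} _ → P≗Q x))

    countB-∨-∧ : (P Q : A → Bool) (xs : List A) →
      countB (λ x → P x ∨ Q x) xs + countB (λ x → P x ∧ Q x) xs ≡ countB P xs + countB Q xs
    countB-∨-∧ P Q [] = refl
    countB-∨-∧ P Q (x ∷ xs) with P x | Q x | countB-∨-∧ P Q xs
    ... | true  | true  | ih = cong suc (trans (+-suc _ _) (trans (cong suc ih) (sym (+-suc _ _))))
    ... | true  | false | ih = cong suc ih
    ... | false | true  | ih = trans (cong suc ih) (sym (+-suc _ _))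
    ... | false | false | ih = ih

    countB-none-All : (P : A → Bool) (xs : List A) → All (λ x → P x ≡ false) xs → countB P xs ≡ 0
    countB-none-All P []       []              = refl
    countB-none-All P (x ∷ xs) (Px≡false ∷ es) rewrite Px≡false = countB-none-All P xs es

    countB-none : (P : A → Bool) (xs : List A) → (∀ x → P x ≡ false) → countB P xs ≡ 0
    countB-none P xs P≡false = countB-none-All P xs (All.tabulate (λ {x} _ → P≡false x))

    countB-∨-disjoint : (P Q : A → Bool) (xs : List A) → (∀ x → P x ∧ Q x ≡ false) →
      countB (λ x → P x ∨ Q x) xs ≡ countB P xs + countB Q xs
    countB-∨-disjoint P Q xs P∧Q≡false = begin
        countB (λ x → P x ∨ Q x) xs
      ≡⟨ sym (+-identityʳ _) ⟩
        countB (λ x → P x ∨ Q x) xs + 0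
      ≡⟨ cong (countB (λ x → P x ∨ Q x) xs +_) (sym (countB-none _ xs P∧Q≡false)) ⟩
        countB (λ x → P x ∨ Q x) xs + countB (λ x → P x ∧ Q x) xs
      ≡⟨ countB-∨-∧ P Q xs ⟩
        countB P xs + countB Q xs ∎
      where open ≡-Reasoning

    countB-const-∧ : (b : Bool) (P : A → Bool) (xs : List A) →
      countB (λ x → b ∧ P x) xs ≡ (if b then countB P xs else 0)
    countB-const-∧ true  P xs       = refl
    countB-const-∧ false P []       = refl
    countB-const-∧ false P (x ∷ xs) = countB-const-∧ false P xs

    countB-filterᵇ : (P Q : A → Bool) (xs : List A) → countB P (filterᵇ Q xs) ≡ countB (λ x → Q x ∧ P x) xs
    countB-filterᵇ P Q [] = refl
    countB-filterᵇ P Q (x ∷ xs) with Q x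
    ... | false = countB-filterᵇ P Q xs
    ... | true with P x
    ...   | true  = cong suc (countB-filterᵇ P Q xs)
    ...   | false = countB-filterᵇ P Q xs

    countB-+-not : (P : A → Bool) (xs : List A) → countB P xs + countB (λ x → not (P x)) xs ≡ length xs
    countB-+-not P [] = refl
    countB-+-not P (x ∷ xs) with P x
    ... | true  = cong suc (countB-+-not P xs)
    ... | false = trans (+-suc _ _) (cong suc (countB-+-not P xs))

    countB-true : (xs : List A) → countB (λ _ → true) xs ≡ length xs
    countB-true []       = refl
    countB-true (x ∷ xs) = cong suc (countB-true xs)

    sum-cong : {f g : A → ℕ} (xs : List A) → (∀ x → f x ≡ g x) → sum (map f xs) ≡ sum (map g xs)
    sum-cong []       f≗g = refl
    sum-cong (x ∷ xs) f≗g = cong₂ _+_ (f≗g x) (sum-cong xs f≗g)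

    sum-zero : {f : A → ℕ} (xs : List A) → (∀ x → f x ≡ 0) → sum (map f xs) ≡ 0
    sum-zero []       f≡0 = refl
    sum-zero (x ∷ xs) f≡0 = cong₂ _+_ (f≡0 x) (sum-zero xs f≡0)

    sum-indicator : (P : A → Bool) (k : ℕ) (xs : List A) →
      sum (map (λ x → if P x then k else 0) xs) ≡ countB P xs * k
    sum-indicator P k [] = refl
    sum-indicator P k (x ∷ xs) with P x
    ... | true  = cong (k +_) (sum-indicator P k xs)
    ... | false = sum-indicator P k xs

  module _ {A B : Set} where

    countB-map : (P : B → Bool) (f : A → B) (xs : List A) → countB P (map f xs) ≡ countB (λ x → P (f x)) xs
    countB-map P f [] = refl
    countB-map P f (x ∷ xs) with P (f x)
    ... | true  = cong suc (countB-map P f xs)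
    ... | false = countB-map P f xs

    countB-concatMap : (P : B → Bool) (f : A → List B) (xs : List A) →
      countB P (concatMap f xs) ≡ sum (map (λ x → countB P (f x)) xs)
    countB-concatMap P f []       = refl
    countB-concatMap P f (x ∷ xs) =
      trans (countB-++ P (f x) (concatMap f xs)) (cong (countB P (f x) +_) (countB-concatMap P f xs))

  length-allFin : ∀ n → length (allFin n) ≡ n
  length-allFin n = Listₚ.length-tabulate (λ i → i)

  sum-allFin-delta : ∀ {n} (g : Fin n → ℕ) (b : Fin n) → (∀ a → ¬ a ≡ b → g a ≡ 0) → sum (map g (allFin n)) ≡ g b
  sum-allFin-delta {n} g b g≡0 = trans (cong sum (Listₚ.map-tabulate (λ i → i) g)) (go g b g≡0)
    where
    go : ∀ {m} (h : Fin m → ℕ) (b : Fin m) → (∀ a → ¬ a ≡ b → h a ≡ 0) → sum (tabulate h) ≡ h b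
    go {suc m} h Fin.zero h≡0 =
      trans (cong (h Fin.zero +_) (trans (sym (cong sum (Listₚ.map-tabulate (λ i → i) (λ a → h (Fin.suc a)))))
                                         (sum-zero (allFin m) (λ a → h≡0 (Fin.suc a) (λ ())))))
            (+-identityʳ _)
    go h (Fin.suc b) h≡0 = cong₂ _+_ (h≡0 Fin.zero (λ ())) (go (λ a → h (Fin.suc a)) b
                             (λ a a≢b → h≡0 (Fin.suc a) (λ e → a≢b (Finₚ.suc-injective e))))

  countB-allFin-delta : ∀ {n} (Q : Fin n → Bool) (b : Fin n) → (∀ a → ¬ a ≡ b → Q a ≡ false) →
    countB Q (allFin n) ≡ (if Q b then 1 else 0)
  countB-allFin-delta {n} Q b Q≡false = begin
    countB Q (allFin n)                                  ≡⟨ sym (*-identityʳ _) ⟩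
    countB Q (allFin n) * 1                              ≡⟨ sym (sum-indicator Q 1 (allFin n)) ⟩
    sum (map (λ a → if Q a then 1 else 0) (allFin n))   ≡⟨ sum-allFin-delta _ b (λ a a≢b →
                                                             cong (λ x → if x then 1 else 0) (Q≡false a a≢b)) ⟩
    (if Q b then 1 else 0)                               ∎
    where open ≡-Reasoning

  -- Counting permutations with prescribed ends

  freshB : ∀ {n} → List (Fin n) → List (Fin n) → Bool
  freshB A []       = true
  freshB A (x ∷ xs) = not (elemB x A) ∧ freshB A xs

  distinctOutside : ∀ {n} → List (Fin n) → List (Fin n) → Bool
  distinctOutside A u = distinctB u ∧ freshB A u

  framedB : ∀ {n} → List (Fin n) → List (Fin n) → List (Fin n) → Bool
  framedB F W u = eqWord (take (length F) u) F ∧ eqWord (take (length W) (reverse u)) (reverse W)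

  if-∧ : {A : Set} (b c : Bool) (x y : A) → (if b then (if c then x else y) else y) ≡ (if b ∧ c then x else y)
  if-∧ true  c x y = refl
  if-∧ false c x y = refl

  not-∨ : ∀ x y → not (x ∨ y) ≡ not x ∧ not y
  not-∨ true  y = refl
  not-∨ false y = refl

  ∧-left-comm : ∀ x y z → x ∧ (y ∧ z) ≡ y ∧ (x ∧ z)
  ∧-left-comm = solve 3 (λ x y z → x ⊕ (y ⊕ z) ⊜ y ⊕ (x ⊕ z)) refl

  module _ {A : Set} where

    take-++ˡ : ∀ k (xs ys : List A) → k ≤ length xs → take k (xs ++ ys) ≡ take k xs
    take-++ˡ zero    xs       ys _         = refl
    take-++ˡ (suc k) (x ∷ xs) ys (s≤s k≤n) = cong (x ∷_) (take-++ˡ k xs ys k≤n)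

    take-reverse-∷ : ∀ k (a : A) (u : List A) → k ≤ length u → take k (reverse (a ∷ u)) ≡ take k (reverse u)
    take-reverse-∷ k a u k≤|u| = trans (cong (take k) (Listₚ.unfold-reverse a u))
      (take-++ˡ k (reverse u) (a ∷ []) (subst (k ≤_) (sym (Listₚ.length-reverse u)) k≤|u|))

  module _ {n : ℕ} where

    freshB-[] : (u : List (Fin n)) → freshB [] u ≡ true
    freshB-[] []       = refl
    freshB-[] (x ∷ u) = freshB-[] u

    freshB-∷ : (a : Fin n) (A u : List (Fin n)) → freshB (a ∷ A) u ≡ not (elemB a u) ∧ freshB A u
    freshB-∷ a A []       = refl
    freshB-∷ a A (x ∷ xs) rewrite freshB-∷ a A xs | eqFin-sym x a with eqFin a x
    ... | true  = refl
    ... | false = ∧-left-comm (not (elemB x A)) (not (elemB a xs)) (freshB A xs)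

    distinctOutside-[] : (u : List (Fin n)) → distinctOutside [] u ≡ distinctB u
    distinctOutside-[] u = trans (cong (distinctB u ∧_) (freshB-[] u)) (Boolₚ.∧-identityʳ (distinctB u))

    distinctOutside-∷ : (a : Fin n) (A u : List (Fin n)) →
      distinctOutside A (a ∷ u) ≡ not (elemB a A) ∧ distinctOutside (a ∷ A) u
    distinctOutside-∷ a A u rewrite freshB-∷ a A u =
      solve 4 (λ x₁ x₂ x₃ x₄ → (x₁ ⊕ x₂) ⊕ (x₃ ⊕ x₄) ⊜ x₃ ⊕ (x₂ ⊕ (x₁ ⊕ x₄))) refl
        (not (elemB a u)) (distinctB u) (not (elemB a A)) (freshB A u)

    elemB-++ : (a : Fin n) (A W : List (Fin n)) → elemB a (A ++ W) ≡ elemB a A ∨ elemB a W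
    elemB-++ a []      W = refl
    elemB-++ a (x ∷ A) W rewrite elemB-++ a A W = sym (Boolₚ.∨-assoc (eqFin a x) (elemB a A) (elemB a W))

    distinctOutside-∷-elemB : (a : Fin n) (A W : List (Fin n)) →
      distinctOutside A (a ∷ W) ≡ distinctOutside A W ∧ not (elemB a (A ++ W))
    distinctOutside-∷-elemB a A W rewrite elemB-++ a A W | not-∨ (elemB a A) (elemB a W) =
      solve 4 (λ x₁ x₂ x₃ x₄ → (x₁ ⊕ x₂) ⊕ (x₃ ⊕ x₄) ⊜ (x₂ ⊕ x₄) ⊕ (x₃ ⊕ x₁)) refl
        (not (elemB a W)) (distinctB W) (not (elemB a A)) (freshB A W)

    distinctB-++ : (A W : List (Fin n)) → distinctB (A ++ W) ≡ distinctB A ∧ distinctOutside A W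
    distinctB-++ []      W = sym (distinctOutside-[] W)
    distinctB-++ (x ∷ A) W rewrite distinctB-++ A W | elemB-++ x A W | not-∨ (elemB x A) (elemB x W) | freshB-∷ x A W =
      solve 5 (λ x₁ x₂ x₃ x₄ x₅ → (x₁ ⊕ x₂) ⊕ (x₃ ⊕ (x₄ ⊕ x₅)) ⊜ (x₁ ⊕ x₃) ⊕ (x₄ ⊕ (x₂ ⊕ x₅))) refl
        (not (elemB x A)) (not (elemB x W)) (distinctB A) (distinctB W) (freshB A W)

    countB-elemB : (B : List (Fin n)) → distinctB B ≡ true → countB (λ a → elemB a B) (allFin n) ≡ length B
    countB-elemB []      _   = countB-none _ (allFin n) (λ _ → refl)
    countB-elemB (b ∷ B) dbB with not (elemB b B) in b∉B | distinctB B in dB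
    countB-elemB (b ∷ B) () | false | _
    countB-elemB (b ∷ B) () | true  | false
    ... | true | true = begin
        countB (λ a → eqFin a b ∨ elemB a B) (allFin n)
      ≡⟨ countB-∨-disjoint (λ a → eqFin a b) (λ a → elemB a B) (allFin n) b-once ⟩
        countB (λ a → eqFin a b) (allFin n) + countB (λ a → elemB a B) (allFin n)
      ≡⟨ cong₂ _+_ (countB-allFin-delta (λ a → eqFin a b) b (λ a → eqFin-false)) (countB-elemB B dB) ⟩
        (if eqFin b b then 1 else 0) + length B
      ≡⟨ cong (λ x → (if x then 1 else 0) + length B) (eqFin-refl b) ⟩
        suc (length B) ∎
      where
      open ≡-Reasoning
      b-once : ∀ a → (eqFin a b ∧ elemB a B) ≡ false
      b-once a with a Fin.≟ b
      ... | yes refl = Boolₚ.not-injective b∉B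
      ... | no _     = refl

    countB-not-elemB : (B : List (Fin n)) → distinctB B ≡ true → countB (λ a → not (elemB a B)) (allFin n) ≡ n ∸ length B
    countB-not-elemB B dB = begin
        countB (λ a → not (elemB a B)) (allFin n)
      ≡⟨ sym (m+n∸m≡n (length B) _) ⟩
        length B + countB (λ a → not (elemB a B)) (allFin n) ∸ length B
      ≡⟨ cong (λ k → k + countB (λ a → not (elemB a B)) (allFin n) ∸ length B) (sym (countB-elemB B dB)) ⟩
        countB (λ a → elemB a B) (allFin n) + countB (λ a → not (elemB a B)) (allFin n) ∸ length B
      ≡⟨ cong (_∸ length B) (trans (countB-+-not (λ a → elemB a B) (allFin n)) (length-allFin n)) ⟩
        n ∸ length B ∎
      where open ≡-Reasoning

    words-length : ∀ m → All (λ u → length u ≡ m) (words n m)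
    words-length zero    = refl ∷ []
    words-length (suc m) = Allₚ.concat⁺ (Allₚ.map⁺ (All.tabulate {xs = allFin n} (λ {a} _ →
      Allₚ.map⁺ {f = a ∷_} (All.map (cong suc) (words-length m)))))

    countB-words-suc : (P : List (Fin n) → Bool) (Q : Fin n → List (Fin n) → Bool) (m : ℕ) →
      (∀ a u → length u ≡ m → P (a ∷ u) ≡ Q a u) →
      countB P (words n (suc m)) ≡ sum (map (λ a → countB (Q a) (words n m)) (allFin n))
    countB-words-suc P Q m P≗Q = trans (countB-concatMap P (λ a → map (a ∷_) (words n m)) (allFin n))
      (sum-cong (allFin n) (λ a → trans (countB-map P (a ∷_) (words n m))
        (countB-cong-All (words n m) (All.map (λ {u} → P≗Q a u) (words-length m)))))

    countB-eqWord : (w : List (Fin n)) → countB (λ u → eqWord u w) (words n (length w)) ≡ 1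
    countB-eqWord []      = refl
    countB-eqWord (b ∷ w) = begin
        countB (λ u → eqWord u (b ∷ w)) (words n (suc (length w)))
      ≡⟨ countB-words-suc _ (λ a u → eqFin a b ∧ eqWord u w) (length w) (λ a u _ → eqWord-∷ a b u w) ⟩
        sum (map (λ a → countB (λ u → eqFin a b ∧ eqWord u w) ws) (allFin n))
      ≡⟨ sum-allFin-delta _ b (λ a a≢b → trans (cong (λ z → countB (λ u → z ∧ eqWord u w) ws) (eqFin-false a≢b))
                                                 (countB-const-∧ false (λ u → eqWord u w) ws)) ⟩
        countB (λ u → eqFin b b ∧ eqWord u w) ws
      ≡⟨ cong (λ z → countB (λ u → z ∧ eqWord u w) ws) (eqFin-refl b) ⟩
        countB (λ u → eqWord u w) ws
      ≡⟨ countB-eqWord w ⟩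
        1 ∎
      where
      open ≡-Reasoning
      ws = words n (length w)

    framedB-∷ : (f : Fin n) (F W : List (Fin n)) (a : Fin n) (u : List (Fin n)) → length W ≤ length u →
      framedB (f ∷ F) W (a ∷ u) ≡ eqFin a f ∧ framedB F W u
    framedB-∷ f F W a u |W|≤|u| rewrite take-reverse-∷ (length W) a u |W|≤|u| | eqWord-∷ a f (take (length F) u) F =
      Boolₚ.∧-assoc (eqFin a f) _ _

    framedB-[]-∷ : (W : List (Fin n)) (a : Fin n) (u : List (Fin n)) → length W ≤ length u →
      framedB [] W (a ∷ u) ≡ framedB [] W u
    framedB-[]-∷ W a u |W|≤|u| = cong (λ v → eqWord v (reverse W)) (take-reverse-∷ (length W) a u |W|≤|u|)

    -- Fill the positions left to right, adding each chosen letter to A. The invariant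
    -- |A| + |F| + d + |W| = n says that the first of the d free positions has d admissible letters.
    mutual
      countB-framed : (F W A : List (Fin n)) (d : ℕ) → distinctB A ≡ true →
        length A + (length F + (d + length W)) ≡ n →
        countB (λ u → distinctOutside A u ∧ framedB F W u) (words n (length F + (d + length W)))
          ≡ (if distinctOutside A (F ++ W) then d ! else 0)
      countB-framed [] W A zero _ _ = begin
          countB (λ u → distinctOutside A u ∧ framedB [] W u) ws
        ≡⟨ countB-cong-All ws (All.map (λ {u} → only-W u) (words-length (length W))) ⟩
          countB (λ u → distinctOutside A W ∧ eqWord u W) ws
        ≡⟨ countB-const-∧ (distinctOutside A W) (λ u → eqWord u W) ws ⟩
          (if distinctOutside A W then countB (λ u → eqWord u W) ws else 0)
        ≡⟨ cong (λ k → if distinctOutside A W then k else 0) (countB-eqWord W) ⟩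
          (if distinctOutside A W then 1 else 0) ∎
        where
        open ≡-Reasoning
        ws = words n (length W)
        only-W : ∀ u → length u ≡ length W → (distinctOutside A u ∧ framedB [] W u) ≡ (distinctOutside A W ∧ eqWord u W)
        only-W u |u|≡|W|
          rewrite Listₚ.take-all (length W) (reverse u) (≤-reflexive (trans (Listₚ.length-reverse u) |u|≡|W|))
                | eqWord-reverse u W
          with Listₚ.≡-dec Fin._≟_ u W
        ... | yes refl = refl
        ... | no _     = trans (Boolₚ.∧-zeroʳ _) (sym (Boolₚ.∧-zeroʳ _))
      countB-framed [] W A (suc d) dA |A|+suc[d+|W|]≡n = begin
          countB (λ u → distinctOutside A u ∧ framedB [] W u) (words n (suc (d + length W)))
        ≡⟨ countB-words-suc _ (λ a u → not (elemB a A) ∧ (distinctOutside (a ∷ A) u ∧ framedB [] W u)) (d + length W)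
             (λ a u |u| → trans (cong₂ _∧_ (distinctOutside-∷ a A u) (framedB-[]-∷ W a u (|W|≤ u |u|)))
                                (Boolₚ.∧-assoc (not (elemB a A)) _ _)) ⟩
          sum (map (λ a → countB (λ u → not (elemB a A) ∧ (distinctOutside (a ∷ A) u ∧ framedB [] W u)) ws) (allFin n))
        ≡⟨ sum-cong (allFin n) (λ a → trans (countB-framed-∷ a [] W A d dA (trans (sym (+-suc _ _)) |A|+suc[d+|W|]≡n))
                                           (cong (λ b → if b then d ! else 0) (distinctOutside-∷-elemB a A W))) ⟩
          sum (map (λ a → if distinctOutside A W ∧ not (elemB a (A ++ W)) then d ! else 0) (allFin n))
        ≡⟨ sum-indicator (λ a → distinctOutside A W ∧ not (elemB a (A ++ W))) (d !) (allFin n) ⟩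
          countB (λ a → distinctOutside A W ∧ not (elemB a (A ++ W))) (allFin n) * d !
        ≡⟨ cong (_* d !) (countB-const-∧ (distinctOutside A W) (λ a → not (elemB a (A ++ W))) (allFin n)) ⟩
          (if distinctOutside A W then countB (λ a → not (elemB a (A ++ W))) (allFin n) else 0) * d !
        ≡⟨ free-choices (distinctOutside A W) refl ⟩
          (if distinctOutside A W then suc d ! else 0) ∎
        where
        open ≡-Reasoning
        ws = words n (d + length W)
        |W|≤ : ∀ u → length u ≡ d + length W → length W ≤ length u
        |W|≤ u |u| = subst (length W ≤_) (sym |u|) (m≤n+m (length W) d)
        free-letters : n ∸ length (A ++ W) ≡ suc d
        free-letters = begin
          n ∸ length (A ++ W)                            ≡⟨ cong₂ _∸_ (sym |A|+suc[d+|W|]≡n) (Listₚ.length-++ A) ⟩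
          length A + suc (d + length W) ∸ (length A + length W) ≡⟨ [m+n]∸[m+o]≡n∸o (length A) _ _ ⟩
          suc d + length W ∸ length W                    ≡⟨ m+n∸n≡m (suc d) (length W) ⟩
          suc d                                          ∎
        free-choices : ∀ b → b ≡ distinctOutside A W →
          (if b then countB (λ a → not (elemB a (A ++ W))) (allFin n) else 0) * d ! ≡ (if b then suc d ! else 0)
        free-choices false _  = refl
        free-choices true  dW = cong (_* d !) (trans
          (countB-not-elemB (A ++ W) (trans (distinctB-++ A W) (cong₂ _∧_ dA (sym dW)))) free-letters)
      countB-framed (f ∷ F) W A d dA |A|+suc[m]≡n = begin
          countB (λ u → distinctOutside A u ∧ framedB (f ∷ F) W u) (words n (suc m))
        ≡⟨ countB-words-suc _ (λ a u → eqFin a f ∧ (not (elemB a A) ∧ (distinctOutside (a ∷ A) u ∧ framedB F W u))) m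
             (λ a u |u| → trans (cong₂ _∧_ (distinctOutside-∷ a A u) (framedB-∷ f F W a u (|W|≤ u |u|)))
               (solve 4 (λ x₁ x₂ x₃ x₄ → (x₁ ⊕ x₂) ⊕ (x₃ ⊕ x₄) ⊜ x₃ ⊕ (x₁ ⊕ (x₂ ⊕ x₄))) refl
                 (not (elemB a A)) (distinctOutside (a ∷ A) u) (eqFin a f) (framedB F W u))) ⟩
          sum (map (λ a → countB (λ u → eqFin a f ∧ (not (elemB a A) ∧ (distinctOutside (a ∷ A) u ∧ framedB F W u))) ws) (allFin n))
        ≡⟨ sum-allFin-delta _ f (λ a a≢f →
             trans (cong (λ b → countB (λ u → b ∧ (not (elemB a A) ∧ (distinctOutside (a ∷ A) u ∧ framedB F W u))) ws) (eqFin-false a≢f))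
                   (countB-const-∧ false (λ u → not (elemB a A) ∧ (distinctOutside (a ∷ A) u ∧ framedB F W u)) ws)) ⟩
          countB (λ u → eqFin f f ∧ (not (elemB f A) ∧ (distinctOutside (f ∷ A) u ∧ framedB F W u))) ws
        ≡⟨ cong (λ b → countB (λ u → b ∧ (not (elemB f A) ∧ (distinctOutside (f ∷ A) u ∧ framedB F W u))) ws) (eqFin-refl f) ⟩
          countB (λ u → not (elemB f A) ∧ (distinctOutside (f ∷ A) u ∧ framedB F W u)) ws
        ≡⟨ countB-framed-∷ f F W A d dA (trans (sym (+-suc _ _)) |A|+suc[m]≡n) ⟩
          (if distinctOutside A (f ∷ F ++ W) then d ! else 0) ∎
        where
        open ≡-Reasoning
        m = length F + (d + length W)
        ws = words n m
        |W|≤ : ∀ u → length u ≡ m → length W ≤ length u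
        |W|≤ u |u| = subst (length W ≤_) (sym |u|) (≤-trans (m≤n+m (length W) d) (m≤n+m (d + length W) (length F)))

      countB-framed-∷ : (a : Fin n) (F W A : List (Fin n)) (d : ℕ) → distinctB A ≡ true →
        suc (length A + (length F + (d + length W))) ≡ n →
        countB (λ u → not (elemB a A) ∧ (distinctOutside (a ∷ A) u ∧ framedB F W u)) (words n (length F + (d + length W)))
          ≡ (if distinctOutside A (a ∷ F ++ W) then d ! else 0)
      countB-framed-∷ a F W A d dA len = begin
          countB (λ u → not (elemB a A) ∧ R u) ws
        ≡⟨ countB-const-∧ (not (elemB a A)) R ws ⟩
          (if not (elemB a A) then countB R ws else 0)
        ≡⟨ fresh-first-letter (not (elemB a A)) refl ⟩
          (if not (elemB a A) then (if distinctOutside (a ∷ A) (F ++ W) then d ! else 0) else 0)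
        ≡⟨ if-∧ (not (elemB a A)) (distinctOutside (a ∷ A) (F ++ W)) (d !) 0 ⟩
          (if not (elemB a A) ∧ distinctOutside (a ∷ A) (F ++ W) then d ! else 0)
        ≡⟨ cong (λ b → if b then d ! else 0) (sym (distinctOutside-∷ a A (F ++ W))) ⟩
          (if distinctOutside A (a ∷ F ++ W) then d ! else 0) ∎
        where
        open ≡-Reasoning
        R = λ u → distinctOutside (a ∷ A) u ∧ framedB F W u
        ws = words n (length F + (d + length W))
        fresh-first-letter : ∀ b → b ≡ not (elemB a A) →
          (if b then countB R ws else 0) ≡ (if b then (if distinctOutside (a ∷ A) (F ++ W) then d ! else 0) else 0)
        fresh-first-letter false _   = refl
        fresh-first-letter true  a∉A = countB-framed F W (a ∷ A) d (trans (cong (_∧ distinctB A) (sym a∉A)) dA) len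

  countB-framed-vertices : ∀ {n} (F W : List (Fin n)) → length F + length W ≤ n →
    countB (framedB F W) (vertices n) ≡ (if distinctB (F ++ W) then (n ∸ (length F + length W)) ! else 0)
  countB-framed-vertices {n} F W |F|+|W|≤n = begin
      countB (framedB F W) (vertices n)
    ≡⟨ countB-filterᵇ (framedB F W) distinctB (words n n) ⟩
      countB (λ u → distinctB u ∧ framedB F W u) (words n n)
    ≡⟨ cong (λ m → countB (λ u → distinctB u ∧ framedB F W u) (words n m)) (sym length≡n) ⟩
      countB (λ u → distinctB u ∧ framedB F W u) (words n (length F + (d + length W)))
    ≡⟨ countB-cong (words n (length F + (d + length W))) (λ u → cong (_∧ framedB F W u) (sym (distinctOutside-[] u))) ⟩
      countB (λ u → distinctOutside [] u ∧ framedB F W u) (words n (length F + (d + length W)))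
    ≡⟨ countB-framed F W [] d refl length≡n ⟩
      (if distinctOutside [] (F ++ W) then d ! else 0)
    ≡⟨ cong (λ b → if b then d ! else 0) (distinctOutside-[] (F ++ W)) ⟩
      (if distinctB (F ++ W) then d ! else 0) ∎
    where
    open ≡-Reasoning
    d = n ∸ (length F + length W)
    length≡n : length F + (d + length W) ≡ n
    length≡n = begin
      length F + (d + length W)   ≡⟨ cong (length F +_) (+-comm d (length W)) ⟩
      length F + (length W + d)   ≡⟨ sym (+-assoc (length F) (length W) d) ⟩
      length F + length W + d     ≡⟨ m+[n∸m]≡n |F|+|W|≤n ⟩
      n                           ∎

  -- Subnetworks, their intersections and their unions

  frame : ∀ {n} → Sub n → List (Fin n) × List (Fin n)
  frame (prefix , a₁ , a₂) = a₁ ∷ a₂ ∷ [] , []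
  frame (middle , a₁ , a₂) = a₁ ∷ [] , a₂ ∷ []
  frame (suffix , a₁ , a₂) = [] , a₁ ∷ a₂ ∷ []

  inSub-framedB : ∀ {n} (s : Sub n) (u : List (Fin n)) → inSub s u ≡ framedB (proj₁ (frame s)) (proj₂ (frame s)) u
  inSub-framedB (prefix , a₁ , a₂) u = sym (Boolₚ.∧-identityʳ _)
  inSub-framedB (middle , a₁ , a₂) u = refl
  inSub-framedB (suffix , a₁ , a₂) u = refl

  frame-++ : ∀ {n} (f : Form) (a₁ a₂ : Fin n) →
    proj₁ (frame (f , a₁ , a₂)) ++ proj₂ (frame (f , a₁ , a₂)) ≡ a₁ ∷ a₂ ∷ []
  frame-++ prefix a₁ a₂ = refl
  frame-++ middle a₁ a₂ = refl
  frame-++ suffix a₁ a₂ = refl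

  distinctB-pair : ∀ {n} {a b : Fin n} → ¬ a ≡ b → distinctB (a ∷ b ∷ []) ≡ true
  distinctB-pair a≢b rewrite eqFin-false a≢b = refl

  countB-inSub : ∀ {n} (f : Form) {a₁ a₂ : Fin n} → ¬ a₁ ≡ a₂ → 2 ≤ n →
    countB (inSub (f , a₁ , a₂)) (vertices n) ≡ (n ∸ 2) !
  countB-inSub {n} f {a₁} {a₂} a₁≢a₂ 2≤n = begin
      countB (inSub (f , a₁ , a₂)) (vertices n)
    ≡⟨ countB-cong (vertices n) (inSub-framedB (f , a₁ , a₂)) ⟩
      countB (framedB F W) (vertices n)
    ≡⟨ countB-framed-vertices F W (subst (_≤ n) (sym |F|+|W|≡2) 2≤n) ⟩
      (if distinctB (F ++ W) then (n ∸ (length F + length W)) ! else 0)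
    ≡⟨ cong₂ (λ b k → if b then (n ∸ k) ! else 0)
         (trans (cong distinctB (frame-++ f a₁ a₂)) (distinctB-pair a₁≢a₂)) |F|+|W|≡2 ⟩
      (n ∸ 2) ! ∎
    where
    open ≡-Reasoning
    F = proj₁ (frame (f , a₁ , a₂))
    W = proj₂ (frame (f , a₁ , a₂))
    |F|+|W|≡2 : length F + length W ≡ 2
    |F|+|W|≡2 = trans (sym (Listₚ.length-++ F)) (cong length (frame-++ f a₁ a₂))

  meetsPM : ∀ {n} → Fin n → Fin n → Fin n → Fin n → Bool
  meetsPM a₁ a₂ b₁ b₂ = eqFin a₁ b₁ ∧ not (eqFin a₂ b₂)

  meetsMS : ∀ {n} → Fin n → Fin n → Fin n → Fin n → Bool
  meetsMS b₁ b₂ a₁ a₂ = eqFin a₂ b₂ ∧ not (eqFin b₁ a₁)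

  eqWord-take-2-1 : ∀ {n} (a c b : Fin n) (v : List (Fin n)) →
    eqWord (take 2 v) (a ∷ c ∷ []) ∧ eqWord (take 1 v) (b ∷ []) ≡ eqFin a b ∧ eqWord (take 2 v) (a ∷ c ∷ [])
  eqWord-take-2-1 a c b []      = sym (Boolₚ.∧-zeroʳ (eqFin a b))
  eqWord-take-2-1 a c b (x ∷ v) rewrite eqWord-∷ x a (take 1 v) (c ∷ []) | eqWord-∷ x b [] [] with x Fin.≟ a
  ... | yes refl = trans (cong (eqWord (take 1 v) (c ∷ []) ∧_) (Boolₚ.∧-identityʳ (eqFin x b)))
                         (Boolₚ.∧-comm (eqWord (take 1 v) (c ∷ [])) (eqFin x b))
  ... | no _     = sym (Boolₚ.∧-zeroʳ _)

  inSub-prefix-middle : ∀ {n} (a₁ a₂ b₁ b₂ : Fin n) (u : List (Fin n)) →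
    inSub (prefix , a₁ , a₂) u ∧ inSub (middle , b₁ , b₂) u ≡ eqFin a₁ b₁ ∧ framedB (a₁ ∷ a₂ ∷ []) (b₂ ∷ []) u
  inSub-prefix-middle a₁ a₂ b₁ b₂ u = begin
      P ∧ (Q ∧ M)            ≡⟨ sym (Boolₚ.∧-assoc P Q M) ⟩
      (P ∧ Q) ∧ M            ≡⟨ cong (_∧ M) (eqWord-take-2-1 a₁ a₂ b₁ u) ⟩
      (eqFin a₁ b₁ ∧ P) ∧ M  ≡⟨ Boolₚ.∧-assoc (eqFin a₁ b₁) P M ⟩
      eqFin a₁ b₁ ∧ (P ∧ M)  ∎
    where
    open ≡-Reasoning
    P = eqWord (take 2 u) (a₁ ∷ a₂ ∷ [])
    Q = eqWord (take 1 u) (b₁ ∷ [])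
    M = eqWord (take 1 (reverse u)) (b₂ ∷ [])

  inSub-middle-suffix : ∀ {n} (b₁ b₂ a₁ a₂ : Fin n) (u : List (Fin n)) →
    inSub (middle , b₁ , b₂) u ∧ inSub (suffix , a₁ , a₂) u ≡ eqFin a₂ b₂ ∧ framedB (b₁ ∷ []) (a₁ ∷ a₂ ∷ []) u
  inSub-middle-suffix b₁ b₂ a₁ a₂ u = begin
      (Q ∧ M) ∧ S            ≡⟨ Boolₚ.∧-assoc Q M S ⟩
      Q ∧ (M ∧ S)            ≡⟨ cong (Q ∧_) (trans (Boolₚ.∧-comm M S) (eqWord-take-2-1 a₂ a₁ b₂ (reverse u))) ⟩
      Q ∧ (eqFin a₂ b₂ ∧ S)  ≡⟨ ∧-left-comm Q (eqFin a₂ b₂) S ⟩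
      eqFin a₂ b₂ ∧ (Q ∧ S)  ∎
    where
    open ≡-Reasoning
    Q = eqWord (take 1 u) (b₁ ∷ [])
    M = eqWord (take 1 (reverse u)) (b₂ ∷ [])
    S = eqWord (take 2 (reverse u)) (a₂ ∷ a₁ ∷ [])

  countB-prefix-middle : ∀ {n} {a₁ a₂ b₁ b₂ : Fin n} → ¬ a₁ ≡ a₂ → ¬ b₁ ≡ b₂ → 3 ≤ n →
    countB (λ u → inSub (prefix , a₁ , a₂) u ∧ inSub (middle , b₁ , b₂) u) (vertices n)
      ≡ (if meetsPM a₁ a₂ b₁ b₂ then (n ∸ 3) ! else 0)
  countB-prefix-middle {n} {a₁} {a₂} {b₁} {b₂} a₁≢a₂ b₁≢b₂ 3≤n = begin
      countB (λ u → inSub (prefix , a₁ , a₂) u ∧ inSub (middle , b₁ , b₂) u) (vertices n)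
    ≡⟨ countB-cong (vertices n) (inSub-prefix-middle a₁ a₂ b₁ b₂) ⟩
      countB (λ u → eqFin a₁ b₁ ∧ framedB (a₁ ∷ a₂ ∷ []) (b₂ ∷ []) u) (vertices n)
    ≡⟨ countB-const-∧ (eqFin a₁ b₁) _ (vertices n) ⟩
      (if eqFin a₁ b₁ then countB (framedB (a₁ ∷ a₂ ∷ []) (b₂ ∷ [])) (vertices n) else 0)
    ≡⟨ cong (λ k → if eqFin a₁ b₁ then k else 0) (countB-framed-vertices (a₁ ∷ a₂ ∷ []) (b₂ ∷ []) 3≤n) ⟩
      (if eqFin a₁ b₁ then (if distinctB (a₁ ∷ a₂ ∷ b₂ ∷ []) then (n ∸ 3) ! else 0) else 0)
    ≡⟨ meets-iff ⟩
      (if meetsPM a₁ a₂ b₁ b₂ then (n ∸ 3) ! else 0) ∎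
    where
    open ≡-Reasoning
    meets-iff : (if eqFin a₁ b₁ then (if distinctB (a₁ ∷ a₂ ∷ b₂ ∷ []) then (n ∸ 3) ! else 0) else 0)
              ≡ (if meetsPM a₁ a₂ b₁ b₂ then (n ∸ 3) ! else 0)
    meets-iff with a₁ Fin.≟ b₁
    ... | no _     = refl
    ... | yes refl rewrite eqFin-false a₁≢a₂ | eqFin-false b₁≢b₂ with eqFin a₂ b₂
    ...   | true  = refl
    ...   | false = refl

  countB-middle-suffix : ∀ {n} {b₁ b₂ a₁ a₂ : Fin n} → ¬ b₁ ≡ b₂ → ¬ a₁ ≡ a₂ → 3 ≤ n →
    countB (λ u → inSub (middle , b₁ , b₂) u ∧ inSub (suffix , a₁ , a₂) u) (vertices n)
      ≡ (if meetsMS b₁ b₂ a₁ a₂ then (n ∸ 3) ! else 0)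
  countB-middle-suffix {n} {b₁} {b₂} {a₁} {a₂} b₁≢b₂ a₁≢a₂ 3≤n = begin
      countB (λ u → inSub (middle , b₁ , b₂) u ∧ inSub (suffix , a₁ , a₂) u) (vertices n)
    ≡⟨ countB-cong (vertices n) (inSub-middle-suffix b₁ b₂ a₁ a₂) ⟩
      countB (λ u → eqFin a₂ b₂ ∧ framedB (b₁ ∷ []) (a₁ ∷ a₂ ∷ []) u) (vertices n)
    ≡⟨ countB-const-∧ (eqFin a₂ b₂) _ (vertices n) ⟩
      (if eqFin a₂ b₂ then countB (framedB (b₁ ∷ []) (a₁ ∷ a₂ ∷ [])) (vertices n) else 0)
    ≡⟨ cong (λ k → if eqFin a₂ b₂ then k else 0) (countB-framed-vertices (b₁ ∷ []) (a₁ ∷ a₂ ∷ []) 3≤n) ⟩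
      (if eqFin a₂ b₂ then (if distinctB (b₁ ∷ a₁ ∷ a₂ ∷ []) then (n ∸ 3) ! else 0) else 0)
    ≡⟨ meets-iff ⟩
      (if meetsMS b₁ b₂ a₁ a₂ then (n ∸ 3) ! else 0) ∎
    where
    open ≡-Reasoning
    meets-iff : (if eqFin a₂ b₂ then (if distinctB (b₁ ∷ a₁ ∷ a₂ ∷ []) then (n ∸ 3) ! else 0) else 0)
              ≡ (if meetsMS b₁ b₂ a₁ a₂ then (n ∸ 3) ! else 0)
    meets-iff with a₂ Fin.≟ b₂
    ... | no _     = refl
    ... | yes refl rewrite eqFin-false b₁≢b₂ | eqFin-false a₁≢a₂ with eqFin b₁ a₁
    ...   | true  = refl
    ...   | false = refl

  ∧-≡-true : ∀ {x y : Bool} → x ∧ y ≡ true → x ≡ true × y ≡ true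
  ∧-≡-true {true} {true} _ = refl , refl

  ∧-≡-false : ∀ {x y : Bool} → (x ≡ true → y ≡ true → ⊥) → x ∧ y ≡ false
  ∧-≡-false {false}         _ = refl
  ∧-≡-false {true} {false}  _ = refl
  ∧-≡-false {true} {true}   f = ⊥-elim (f refl refl)

  Disjoint : ∀ {n} → Sub n → Sub n → Set
  Disjoint s t = ∀ u → inSub s u ∧ inSub t u ≡ false

  middle-disjoint : ∀ {n} {b₁ b₂ c₁ c₂ : Fin n} →
    ¬ (middle , b₁ , b₂) ≡ (middle , c₁ , c₂) → Disjoint (middle , b₁ , b₂) (middle , c₁ , c₂)
  middle-disjoint {n} {b₁} {b₂} {c₁} {c₂} s≢t u = ∧-≡-false same
    where
    same : inSub (middle , b₁ , b₂) u ≡ true → inSub (middle , c₁ , c₂) u ≡ true → ⊥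
    same u∈s u∈t with ∧-≡-true {eqWord (take 1 u) (b₁ ∷ [])} u∈s | ∧-≡-true {eqWord (take 1 u) (c₁ ∷ [])} u∈t
    ... | first-b , last-b | first-c , last-c = s≢t (cong (_,_ {B = λ _ → Fin n × Fin n} middle) (cong₂ _,_
      (Listₚ.∷-injectiveˡ (trans (sym (eqWord-sound first-b)) (eqWord-sound first-c)))
      (Listₚ.∷-injectiveˡ (trans (sym (eqWord-sound last-b)) (eqWord-sound last-c)))))

  suffix-disjoint : ∀ {n} {b₁ b₂ c₁ c₂ : Fin n} →
    ¬ (suffix , b₁ , b₂) ≡ (suffix , c₁ , c₂) → Disjoint (suffix , b₁ , b₂) (suffix , c₁ , c₂)
  suffix-disjoint {n} {b₁} {b₂} {c₁} {c₂} s≢t u = ∧-≡-false same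
    where
    same : inSub (suffix , b₁ , b₂) u ≡ true → inSub (suffix , c₁ , c₂) u ≡ true → ⊥
    same u∈s u∈t = s≢t (cong (_,_ {B = λ _ → Fin n × Fin n} suffix) (cong₂ _,_
      (Listₚ.∷-injectiveˡ (Listₚ.∷-injectiveʳ last-two)) (Listₚ.∷-injectiveˡ last-two)))
      where
      last-two : b₂ ∷ b₁ ∷ [] ≡ c₂ ∷ c₁ ∷ []
      last-two = trans (sym (eqWord-sound u∈s)) (eqWord-sound u∈t)

  module _ {A : Set} (V : List A) where

    countB-∨₃-disjoint : (Y₁ Y₂ Y₃ : A → Bool) →
      (∀ x → Y₁ x ∧ Y₂ x ≡ false) → (∀ x → Y₁ x ∧ Y₃ x ≡ false) → (∀ x → Y₂ x ∧ Y₃ x ≡ false) →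
      countB (λ x → Y₁ x ∨ (Y₂ x ∨ (Y₃ x ∨ false))) V ≡ countB Y₁ V + (countB Y₂ V + countB Y₃ V)
    countB-∨₃-disjoint Y₁ Y₂ Y₃ d₁₂ d₁₃ d₂₃ = begin
        countB (λ x → Y₁ x ∨ (Y₂ x ∨ (Y₃ x ∨ false))) V
      ≡⟨ countB-cong V (λ x → cong (λ b → Y₁ x ∨ (Y₂ x ∨ b)) (Boolₚ.∨-identityʳ (Y₃ x))) ⟩
        countB (λ x → Y₁ x ∨ (Y₂ x ∨ Y₃ x)) V
      ≡⟨ countB-∨-disjoint Y₁ (λ x → Y₂ x ∨ Y₃ x) V
           (λ x → trans (Boolₚ.∧-distribˡ-∨ (Y₁ x) (Y₂ x) (Y₃ x)) (cong₂ _∨_ (d₁₂ x) (d₁₃ x))) ⟩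
        countB Y₁ V + countB (λ x → Y₂ x ∨ Y₃ x) V
      ≡⟨ cong (countB Y₁ V +_) (countB-∨-disjoint Y₂ Y₃ V d₂₃) ⟩
        countB Y₁ V + (countB Y₂ V + countB Y₃ V) ∎
      where open ≡-Reasoning

    countB-∨-star : (X Y₁ Y₂ Y₃ : A → Bool) →
      (∀ x → Y₁ x ∧ Y₂ x ≡ false) → (∀ x → Y₁ x ∧ Y₃ x ≡ false) → (∀ x → Y₂ x ∧ Y₃ x ≡ false) →
      countB (λ x → X x ∨ (Y₁ x ∨ (Y₂ x ∨ (Y₃ x ∨ false)))) V
        + (countB (λ x → X x ∧ Y₁ x) V + (countB (λ x → X x ∧ Y₂ x) V + countB (λ x → X x ∧ Y₃ x) V))
      ≡ countB X V + (countB Y₁ V + (countB Y₂ V + countB Y₃ V))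
    countB-∨-star X Y₁ Y₂ Y₃ d₁₂ d₁₃ d₂₃ = begin
        countB (λ x → X x ∨ Z x) V + (countB (X∧ Y₁) V + (countB (X∧ Y₂) V + countB (X∧ Y₃) V))
      ≡⟨ cong (countB (λ x → X x ∨ Z x) V +_) (sym (countB-∨₃-disjoint (X∧ Y₁) (X∧ Y₂) (X∧ Y₃)
           (restrict d₁₂) (restrict d₁₃) (restrict d₂₃))) ⟩
        countB (λ x → X x ∨ Z x) V + countB (λ x → (X x ∧ Y₁ x) ∨ ((X x ∧ Y₂ x) ∨ ((X x ∧ Y₃ x) ∨ false))) V
      ≡⟨ cong (countB (λ x → X x ∨ Z x) V +_) (countB-cong V (λ x → sym (∧-distribˡ-∨₃ (X x) (Y₁ x) (Y₂ x) (Y₃ x)))) ⟩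
        countB (λ x → X x ∨ Z x) V + countB (λ x → X x ∧ Z x) V
      ≡⟨ countB-∨-∧ X Z V ⟩
        countB X V + countB Z V
      ≡⟨ cong (countB X V +_) (countB-∨₃-disjoint Y₁ Y₂ Y₃ d₁₂ d₁₃ d₂₃) ⟩
        countB X V + (countB Y₁ V + (countB Y₂ V + countB Y₃ V)) ∎
      where
      open ≡-Reasoning
      Z = λ x → Y₁ x ∨ (Y₂ x ∨ (Y₃ x ∨ false))
      X∧_ : (A → Bool) → A → Bool
      (X∧ Y) x = X x ∧ Y x
      restrict : {Y Y′ : A → Bool} → (∀ x → Y x ∧ Y′ x ≡ false) → ∀ x → (X x ∧ Y x) ∧ (X x ∧ Y′ x) ≡ false
      restrict {Y} {Y′} d x with X x
      ... | true  = d x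
      ... | false = refl
      ∧-distribˡ-∨₃ : ∀ x y₁ y₂ y₃ →
        x ∧ (y₁ ∨ (y₂ ∨ (y₃ ∨ false))) ≡ (x ∧ y₁) ∨ ((x ∧ y₂) ∨ ((x ∧ y₃) ∨ false))
      ∧-distribˡ-∨₃ true  y₁ y₂ y₃ = refl
      ∧-distribˡ-∨₃ false y₁ y₂ y₃ = refl

  unionSize-star : ∀ {n} (c f : ℕ) (meets : Sub n → Bool) (s t₁ t₂ t₃ : Sub n) →
    All (λ x → countB (inSub x) (vertices n) ≡ c) (s ∷ t₁ ∷ t₂ ∷ t₃ ∷ []) →
    All (λ t → countB (λ u → inSub s u ∧ inSub t u) (vertices n) ≡ (if meets t then f else 0)) (t₁ ∷ t₂ ∷ t₃ ∷ []) →
    Disjoint t₁ t₂ → Disjoint t₁ t₃ → Disjoint t₂ t₃ →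
    unionSize (s ∷ t₁ ∷ t₂ ∷ t₃ ∷ []) ≡ 4 * c ∸ countB meets (t₁ ∷ t₂ ∷ t₃ ∷ []) * f
  unionSize-star {n} c f meets s t₁ t₂ t₃ (cₛ ∷ c₁ ∷ c₂ ∷ c₃ ∷ []) (m₁ ∷ m₂ ∷ m₃ ∷ []) d₁₂ d₁₃ d₂₃ =
    begin
      unionSize S                              ≡⟨ sym (m+n∸n≡m (unionSize S) shared) ⟩
      unionSize S + shared ∸ shared          ≡⟨ cong₂ _∸_ inclusion-exclusion shared≡ ⟩
      c + (c + (c + c)) ∸ countB meets ts * f  ≡⟨ cong (λ k → c + (c + (c + k)) ∸ countB meets ts * f) (sym (+-identityʳ c)) ⟩
      4 * c ∸ countB meets ts * f              ∎
    where
    open ≡-Reasoning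
    ts = t₁ ∷ t₂ ∷ t₃ ∷ []
    S = s ∷ ts
    shared = (if meets t₁ then f else 0) + ((if meets t₂ then f else 0) + (if meets t₃ then f else 0))
    inclusion-exclusion : unionSize S + shared ≡ c + (c + (c + c))
    inclusion-exclusion = begin
      unionSize S + shared
        ≡⟨ cong (unionSize S +_) (sym (cong₂ _+_ m₁ (cong₂ _+_ m₂ m₃))) ⟩
      _ ≡⟨ countB-∨-star (vertices n) (inSub s) (inSub t₁) (inSub t₂) (inSub t₃) d₁₂ d₁₃ d₂₃ ⟩
      _ ≡⟨ cong₂ _+_ cₛ (cong₂ _+_ c₁ (cong₂ _+_ c₂ c₃)) ⟩
      c + (c + (c + c)) ∎
    shared≡ : shared ≡ countB meets ts * f
    shared≡ = trans (cong (λ k → (if meets t₁ then f else 0) + ((if meets t₂ then f else 0) + k)) (sym (+-identityʳ _)))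
                     (sum-indicator meets f ts)

  unionSize-rotate : ∀ {n} (s t₁ t₂ t₃ : Sub n) →
    unionSize (t₁ ∷ t₂ ∷ t₃ ∷ s ∷ []) ≡ unionSize (s ∷ t₁ ∷ t₂ ∷ t₃ ∷ [])
  unionSize-rotate {n} s t₁ t₂ t₃ = countB-cong (vertices n) (λ u →
    ∨-Solver.solve 4 (λ x y₁ y₂ y₃ → y₁ ∨-Solver.⊕ (y₂ ∨-Solver.⊕ (y₃ ∨-Solver.⊕ (x ∨-Solver.⊕ ∨-Solver.id)))
                                    ∨-Solver.⊜ x ∨-Solver.⊕ (y₁ ∨-Solver.⊕ (y₂ ∨-Solver.⊕ (y₃ ∨-Solver.⊕ ∨-Solver.id)))) refl
      (inSub s u) (inSub t₁ u) (inSub t₂ u) (inSub t₃ u))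

  AllPairs-≢-concatMap-allFin : ∀ {m} {B : Set} (key : B → Fin m) (f : Fin m → List B) →
    (∀ i → All (λ b → key b ≡ i) (f i)) → (∀ i → AllPairs (λ x y → ¬ x ≡ y) (f i)) →
    AllPairs (λ x y → ¬ x ≡ y) (concatMap f (allFin m))
  AllPairs-≢-concatMap-allFin key f keyed distinct =
    AllPairsₚ.concat⁺ (Allₚ.map⁺ (All.tabulate (λ {i} _ → distinct i)))
      (AllPairsₚ.map⁺ (AllPairsₚ.tabulate⁺ (λ {i} {j} i≢j →
        All.map (λ {x} key-x → All.map (λ {y} key-y x≡y → i≢j (trans (sym key-x) (trans (cong key x≡y) key-y)))
                                       (keyed j))
                (keyed i))))

  not-elemB-pair : ∀ {n} (x α β : Fin n) → not (elemB x (α ∷ β ∷ [])) ≡ not (eqFin α x) ∧ not (eqFin β x)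
  not-elemB-pair x α β rewrite Boolₚ.∨-identityʳ (eqFin x β) | eqFin-sym α x | eqFin-sym β x = not-∨ (eqFin x α) (eqFin x β)

  module _ {n : ℕ} where

    data IsSub (f : Form) : Sub n → Set where
      isSub : {a₁ a₂ : Fin n} → ¬ a₁ ≡ a₂ → IsSub f (f , a₁ , a₂)

    letter₁ letter₂ : Sub n → Fin n
    letter₁ (_ , a₁ , _) = a₁
    letter₂ (_ , _ , a₂) = a₂

    cell : Form → Fin n → Fin n → List (Sub n)
    cell f a₁ a₂ = if eqFin a₁ a₂ then [] else (f , a₁ , a₂) ∷ []

    row : Form → Fin n → List (Sub n)
    row f a₁ = concatMap (cell f a₁) (allFin n)

    subnetworks : Form → List (Sub n)
    subnetworks f = concatMap (row f) (allFin n)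

    cell-IsSub : ∀ f a₁ a₂ → All (λ s → IsSub f s × s ≡ (f , a₁ , a₂)) (cell f a₁ a₂)
    cell-IsSub f a₁ a₂ with a₁ Fin.≟ a₂
    ... | yes _    = []
    ... | no a₁≢a₂ = (isSub a₁≢a₂ , refl) ∷ []

    cell-distinct : ∀ f a₁ a₂ → AllPairs (λ s t → ¬ s ≡ t) (cell f a₁ a₂)
    cell-distinct f a₁ a₂ with a₁ Fin.≟ a₂
    ... | yes _ = []
    ... | no _  = [] ∷ []

    subnetworks-IsSub : ∀ f → All (IsSub f) (subnetworks f)
    subnetworks-IsSub f = Allₚ.concat⁺ (Allₚ.map⁺ (All.tabulate {xs = allFin n} λ {a₁} _ →
      Allₚ.concat⁺ (Allₚ.map⁺ (All.tabulate {xs = allFin n} λ {a₂} _ → All.map proj₁ (cell-IsSub f a₁ a₂)))))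

    subnetworks-distinct : ∀ f → AllPairs (λ s t → ¬ s ≡ t) (subnetworks f)
    subnetworks-distinct f = AllPairs-≢-concatMap-allFin letter₁ (row f)
      (λ a₁ → Allₚ.concat⁺ (Allₚ.map⁺ (All.tabulate {xs = allFin n} λ {a₂} _ → All.map (λ { (_ , refl) → refl }) (cell-IsSub f a₁ a₂))))
      (λ a₁ → AllPairs-≢-concatMap-allFin letter₂ (cell f a₁)
        (λ a₂ → All.map (λ { (_ , refl) → refl }) (cell-IsSub f a₁ a₂)) (cell-distinct f a₁))

    countB-subnetworks : (P : Sub n → Bool) (f : Form) →
      countB P (subnetworks f) ≡ sum (map (λ a₁ → countB (λ a₂ → not (eqFin a₁ a₂) ∧ P (f , a₁ , a₂)) (allFin n)) (allFin n))
    countB-subnetworks P f = trans (countB-concatMap P (row f) (allFin n)) (sum-cong (allFin n) λ a₁ →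
      trans (countB-concatMap P (cell f a₁) (allFin n))
        (trans (sum-cong (allFin n) (countB-cell a₁))
          (trans (sum-indicator (λ a₂ → not (eqFin a₁ a₂) ∧ P (f , a₁ , a₂)) 1 (allFin n)) (*-identityʳ _))))
      where
      countB-cell : ∀ a₁ a₂ → countB P (cell f a₁ a₂) ≡ (if not (eqFin a₁ a₂) ∧ P (f , a₁ , a₂) then 1 else 0)
      countB-cell a₁ a₂ with eqFin a₁ a₂
      ... | true  = refl
      ... | false with P (f , a₁ , a₂)
      ...   | true  = refl
      ...   | false = refl

    length-subnetworks : ∀ f → length (subnetworks f) ≡ n * (n ∸ 1)
    length-subnetworks f = begin
        length (subnetworks f)
      ≡⟨ sym (countB-true (subnetworks f)) ⟩
        countB (λ _ → true) (subnetworks f)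
      ≡⟨ countB-subnetworks (λ _ → true) f ⟩
        sum (map (λ a₁ → countB (λ a₂ → not (eqFin a₁ a₂) ∧ true) (allFin n)) (allFin n))
      ≡⟨ sum-cong (allFin n) others ⟩
        sum (map (λ _ → n ∸ 1) (allFin n))
      ≡⟨ sum-indicator (λ _ → true) (n ∸ 1) (allFin n) ⟩
        countB (λ _ → true) (allFin n) * (n ∸ 1)
      ≡⟨ cong (_* (n ∸ 1)) (trans (countB-true (allFin n)) (length-allFin n)) ⟩
        n * (n ∸ 1) ∎
      where
      open ≡-Reasoning
      others : ∀ a₁ → countB (λ a₂ → not (eqFin a₁ a₂) ∧ true) (allFin n) ≡ n ∸ 1
      others a₁ = trans (countB-cong (allFin n) (λ a₂ → trans (Boolₚ.∧-identityʳ _)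
                          (cong not (trans (eqFin-sym a₁ a₂) (sym (Boolₚ.∨-identityʳ _))))))
                        (countB-not-elemB (a₁ ∷ []) refl)

    countB-meets-first : ∀ f {a c : Fin n} → ¬ a ≡ c →
      countB (λ s → eqFin a (letter₁ s) ∧ not (eqFin c (letter₂ s))) (subnetworks f) ≡ n ∸ 2
    countB-meets-first f {a} {c} a≢c = begin
        countB (λ s → eqFin a (letter₁ s) ∧ not (eqFin c (letter₂ s))) (subnetworks f)
      ≡⟨ countB-subnetworks _ f ⟩
        sum (map (λ a₁ → countB (λ a₂ → not (eqFin a₁ a₂) ∧ (eqFin a a₁ ∧ not (eqFin c a₂))) (allFin n)) (allFin n))
      ≡⟨ sum-allFin-delta _ a (λ a₁ a₁≢a → countB-none _ (allFin n) (λ a₂ →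
           trans (cong (λ b → not (eqFin a₁ a₂) ∧ (b ∧ not (eqFin c a₂))) (eqFin-false (λ e → a₁≢a (sym e))))
                 (Boolₚ.∧-zeroʳ _))) ⟩
        countB (λ a₂ → not (eqFin a a₂) ∧ (eqFin a a ∧ not (eqFin c a₂))) (allFin n)
      ≡⟨ countB-cong (allFin n) (λ a₂ → trans (cong (λ b → not (eqFin a a₂) ∧ (b ∧ not (eqFin c a₂))) (eqFin-refl a))
                                               (sym (not-elemB-pair a₂ a c))) ⟩
        countB (λ a₂ → not (elemB a₂ (a ∷ c ∷ []))) (allFin n)
      ≡⟨ countB-not-elemB (a ∷ c ∷ []) (distinctB-pair a≢c) ⟩
        n ∸ 2 ∎
      where open ≡-Reasoning

    countB-meets-last : ∀ f {α β : Fin n} → ¬ α ≡ β →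
      countB (λ s → eqFin (letter₂ s) β ∧ not (eqFin α (letter₁ s))) (subnetworks f) ≡ n ∸ 2
    countB-meets-last f {α} {β} α≢β = begin
        countB (λ s → eqFin (letter₂ s) β ∧ not (eqFin α (letter₁ s))) (subnetworks f)
      ≡⟨ countB-subnetworks _ f ⟩
        sum (map (λ a₁ → countB (λ a₂ → not (eqFin a₁ a₂) ∧ (eqFin a₂ β ∧ not (eqFin α a₁))) (allFin n)) (allFin n))
      ≡⟨ sum-cong (allFin n) only-β ⟩
        sum (map (λ a₁ → if not (elemB a₁ (α ∷ β ∷ [])) then 1 else 0) (allFin n))
      ≡⟨ sum-indicator (λ a₁ → not (elemB a₁ (α ∷ β ∷ []))) 1 (allFin n) ⟩
        countB (λ a₁ → not (elemB a₁ (α ∷ β ∷ []))) (allFin n) * 1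
      ≡⟨ trans (*-identityʳ _) (countB-not-elemB (α ∷ β ∷ []) (distinctB-pair α≢β)) ⟩
        n ∸ 2 ∎
      where
      open ≡-Reasoning
      only-β : ∀ a₁ → countB (λ a₂ → not (eqFin a₁ a₂) ∧ (eqFin a₂ β ∧ not (eqFin α a₁))) (allFin n)
                    ≡ (if not (elemB a₁ (α ∷ β ∷ [])) then 1 else 0)
      only-β a₁ = trans (countB-allFin-delta _ β (λ a₂ a₂≢β →
          trans (cong (λ b → not (eqFin a₁ a₂) ∧ (b ∧ not (eqFin α a₁))) (eqFin-false a₂≢β)) (Boolₚ.∧-zeroʳ _)))
        (cong (λ b → if b then 1 else 0) (begin
          not (eqFin a₁ β) ∧ (eqFin β β ∧ not (eqFin α a₁)) ≡⟨ cong (λ b → not (eqFin a₁ β) ∧ (b ∧ not (eqFin α a₁))) (eqFin-refl β) ⟩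
          not (eqFin a₁ β) ∧ not (eqFin α a₁)               ≡⟨ cong₂ (λ x y → not x ∧ not y) (eqFin-sym a₁ β) (eqFin-sym α a₁) ⟩
          not (eqFin β a₁) ∧ not (eqFin a₁ α)               ≡⟨ Boolₚ.∧-comm (not (eqFin β a₁)) (not (eqFin a₁ α)) ⟩
          not (eqFin a₁ α) ∧ not (eqFin β a₁)               ≡⟨ cong (λ x → not x ∧ not (eqFin β a₁)) (eqFin-sym a₁ α) ⟩
          not (eqFin α a₁) ∧ not (eqFin β a₁)               ≡⟨ sym (not-elemB-pair a₁ α β) ⟩
          not (elemB a₁ (α ∷ β ∷ []))                       ∎))

  misses-polynomial : ∀ m → (4 + m) * (3 + m) ∸ (2 + m) ≡ m * m + 6 * m + 10
  misses-polynomial m = trans (cong (_∸ (2 + m)) (expand m)) (m+n∸n≡m (m * m + 6 * m + 10) (2 + m))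
    where
    expand : ∀ m → (4 + m) * (3 + m) ≡ (m * m + 6 * m + 10) + (2 + m)
    expand = solve-∀

module _ where

  open import Data.Nat as ℕ using (zero; suc; _!)
  import Data.Nat.Properties as ℕₚ
  open import Data.Nat.Combinatorics using (_C_; nC1≡n; nCk+nC[k+1]≡[n+1]C[k+1])
  import Data.Integer as ℤ
  import Data.Integer.Properties as ℤₚ
  import Data.Nat.Coprimality as Coprimality
  open import Data.Rational using (ℚ; _+_; _-_; _*_; 0ℚ; 1ℚ; mkℚ; _/_)
  open import Data.Rational.Properties using (normalize-coprime; +-assoc; +-identityˡ; +-identityʳ; *-zeroˡ; *-identityˡ; *-distribʳ-+)
  open import Data.Rational.Solver using (module +-*-Solver)
  open +-*-Solver

  ℕtoℚ-mkℚ : ∀ m → ℕtoℚ m ≡ mkℚ (ℤ.+ m) 0 (Coprimality.sym (Coprimality.1-coprimeTo m))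
  ℕtoℚ-mkℚ m = normalize-coprime (Coprimality.sym (Coprimality.1-coprimeTo m))

  ℕtoℚ-+ : ∀ a b → ℕtoℚ (a ℕ.+ b) ≡ ℕtoℚ a + ℕtoℚ b
  ℕtoℚ-+ a b rewrite ℕtoℚ-mkℚ a | ℕtoℚ-mkℚ b =
    sym (cong (_/ 1) (cong₂ ℤ._+_ (ℤₚ.*-identityʳ (ℤ.+ a)) (ℤₚ.*-identityʳ (ℤ.+ b))))

  ℕtoℚ-* : ∀ a b → ℕtoℚ (a ℕ.* b) ≡ ℕtoℚ a * ℕtoℚ b
  ℕtoℚ-* a b rewrite ℕtoℚ-mkℚ a | ℕtoℚ-mkℚ b = sym (cong (_/ 1) (sym (ℤₚ.pos-* a b)))

  ℕtoℚ-suc : ∀ a → ℕtoℚ (suc a) ≡ 1ℚ + ℕtoℚ a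
  ℕtoℚ-suc = ℕtoℚ-+ 1

  sumℚ-++ : (xs ys : List ℚ) → sumℚ (xs ++ ys) ≡ sumℚ xs + sumℚ ys
  sumℚ-++ []       ys = sym (+-identityˡ _)
  sumℚ-++ (x ∷ xs) ys = trans (cong (x +_) (sumℚ-++ xs ys)) (sym (+-assoc x (sumℚ xs) (sumℚ ys)))

  module _ {A : Set} where

    sumℚ-cong-All : {f g : A → ℚ} (xs : List A) → All (λ x → f x ≡ g x) xs → sumℚ (map f xs) ≡ sumℚ (map g xs)
    sumℚ-cong-All []       []       = refl
    sumℚ-cong-All (x ∷ xs) (e ∷ es) = cong₂ _+_ e (sumℚ-cong-All xs es)

    sumℚ-zero : {f : A → ℚ} (xs : List A) → All (λ x → f x ≡ 0ℚ) xs → sumℚ (map f xs) ≡ 0ℚ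
    sumℚ-zero []       []       = refl
    sumℚ-zero (x ∷ xs) (e ∷ es) = trans (cong₂ _+_ e (sumℚ-zero xs es)) (+-identityˡ 0ℚ)

    sumℚ-const : {f : A → ℚ} (c : ℚ) (xs : List A) → All (λ x → f x ≡ c) xs → sumℚ (map f xs) ≡ ℕtoℚ (length xs) * c
    sumℚ-const c []       []       = sym (*-zeroˡ c)
    sumℚ-const {f} c (x ∷ xs) (e ∷ es) = begin
      f x + sumℚ (map f xs)          ≡⟨ cong₂ _+_ e (sumℚ-const c xs es) ⟩
      c + ℕtoℚ (length xs) * c       ≡⟨ solve 2 (λ c l → c :+ l :* c := (con 1ℚ :+ l) :* c) refl c (ℕtoℚ (length xs)) ⟩
      (1ℚ + ℕtoℚ (length xs)) * c    ≡⟨ cong (_* c) (sym (ℕtoℚ-suc (length xs))) ⟩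
      ℕtoℚ (suc (length xs)) * c     ∎
      where open ≡-Reasoning

    sumℚ-filterᵇ : (P : A → Bool) (g : A → ℚ) (xs : List A) →
      sumℚ (map g (filterᵇ P xs)) ≡ sumℚ (map (λ x → if P x then g x else 0ℚ) xs)
    sumℚ-filterᵇ P g [] = refl
    sumℚ-filterᵇ P g (x ∷ xs) with P x
    ... | true  = cong (g x +_) (sumℚ-filterᵇ P g xs)
    ... | false = trans (sumℚ-filterᵇ P g xs) (sym (+-identityˡ _))

  sumℚ-swap : {A B : Set} (H : A → B → ℚ) (xs : List A) (ys : List B) →
    sumℚ (map (λ a → sumℚ (map (H a) ys)) xs) ≡ sumℚ (map (λ b → sumℚ (map (λ a → H a b) xs)) ys)
  sumℚ-swap H []       ys = sym (sumℚ-zero ys (All.tabulate (λ _ → refl)))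
  sumℚ-swap H (x ∷ xs) ys = trans (cong (sumℚ (map (H x) ys) +_) (sumℚ-swap H xs ys)) (sym (split ys))
    where
    split : ∀ ys → sumℚ (map (λ b → H x b + sumℚ (map (λ a → H a b) xs)) ys)
                 ≡ sumℚ (map (H x) ys) + sumℚ (map (λ b → sumℚ (map (λ a → H a b) xs)) ys)
    split []       = sym (+-identityˡ 0ℚ)
    split (y ∷ ys) = trans (cong (H x y + sumℚ (map (λ a → H a y) xs) +_) (split ys))
      (solve 4 (λ a b c d → (a :+ b) :+ (c :+ d) := (a :+ c) :+ (b :+ d)) refl
        (H x y) (sumℚ (map (λ a → H a y) xs)) (sumℚ (map (H x) ys)) (sumℚ (map (λ b → sumℚ (map (λ a → H a b) xs)) ys)))

  -- Sums over k-subsets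

  module _ {A : Set} where

    choose-⊆ : ∀ k (xs : List A) → All (_⊆ xs) (choose k xs)
    choose-⊆ zero    xs       = minimum xs ∷ []
    choose-⊆ (suc k) []       = []
    choose-⊆ (suc k) (x ∷ xs) =
      Allₚ.++⁺ (Allₚ.map⁺ (All.map (refl ∷_) (choose-⊆ k xs))) (All.map (x ∷ʳ_) (choose-⊆ (suc k) xs))

    choose-length : ∀ k (xs : List A) → All (λ S → length S ≡ k) (choose k xs)
    choose-length zero    xs       = refl ∷ []
    choose-length (suc k) []       = []
    choose-length (suc k) (x ∷ xs) =
      Allₚ.++⁺ (Allₚ.map⁺ (All.map (cong suc) (choose-length k xs))) (choose-length (suc k) xs)

    AllPairs-resp-⊆ : {R : A → A → Set} {xs ys : List A} → xs ⊆ ys → AllPairs R ys → AllPairs R xs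
    AllPairs-resp-⊆ []         []         = []
    AllPairs-resp-⊆ (y ∷ʳ xs⊆) (_ ∷ rys)  = AllPairs-resp-⊆ xs⊆ rys
    AllPairs-resp-⊆ (refl ∷ xs⊆) (ry ∷ rys) = All-resp-⊆ xs⊆ ry ∷ AllPairs-resp-⊆ xs⊆ rys

    sumC : ℕ → List A → (List A → ℚ) → ℚ
    sumC k xs F = sumℚ (map F (choose k xs))

    sumC-cong : ∀ k xs {F G : List A → ℚ} → (∀ S → F S ≡ G S) → sumC k xs F ≡ sumC k xs G
    sumC-cong k xs F≗G = sumℚ-cong-All (choose k xs) (All.tabulate (λ {S} _ → F≗G S))

    sumC-cons : ∀ k x xs (F : List A → ℚ) → sumC (suc k) (x ∷ xs) F ≡ sumC k xs (λ S → F (x ∷ S)) + sumC (suc k) xs F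
    sumC-cons k x xs F = begin
      sumℚ (map F (map (x ∷_) (choose k xs) ++ choose (suc k) xs))
        ≡⟨ cong sumℚ (Listₚ.map-++ F (map (x ∷_) (choose k xs)) (choose (suc k) xs)) ⟩
      sumℚ (map F (map (x ∷_) (choose k xs)) ++ map F (choose (suc k) xs))
        ≡⟨ sumℚ-++ (map F (map (x ∷_) (choose k xs))) (map F (choose (suc k) xs)) ⟩
      sumℚ (map F (map (x ∷_) (choose k xs))) + sumC (suc k) xs F
        ≡⟨ cong (λ ys → sumℚ ys + sumC (suc k) xs F) (sym (Listₚ.map-∘ (choose k xs))) ⟩
      sumC k xs (λ S → F (x ∷ S)) + sumC (suc k) xs F ∎
      where open ≡-Reasoning

    sumC-1 : (xs : List A) (F : List A → ℚ) → sumC 1 xs F ≡ sumℚ (map (λ x → F (x ∷ [])) xs)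
    sumC-1 []       F = refl
    sumC-1 (x ∷ xs) F = trans (sumC-cons 0 x xs F) (cong₂ _+_ (+-identityʳ (F (x ∷ []))) (sumC-1 xs F))

    -- a k-subset of xs ++ ys is S ++ T with S ⊆ xs and T ⊆ ys; here only |S| = j contributes
    sumC-++ : (Q : A → Bool) (xs ys : List A) (j m : ℕ) (F : List A → ℚ) →
      All (λ x → Q x ≡ true) xs → All (λ y → Q y ≡ false) ys →
      (∀ S → ¬ countB Q S ≡ j → F S ≡ 0ℚ) →
      sumC (j ℕ.+ m) (xs ++ ys) F ≡ sumC j xs (λ S → sumC m ys (λ T → F (S ++ T)))
    sumC-++ Q [] ys zero m F _ _ _ = sym (+-identityʳ _)
    sumC-++ Q [] ys (suc j) m F _ ys-false F≡0 = sumℚ-zero (choose (suc j ℕ.+ m) ys)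
      (All.map (λ {S} S⊆ys → F≡0 S (λ e → ℕₚ.0≢1+n (trans (sym (countB-none-All Q S (All-resp-⊆ S⊆ys ys-false))) e)))
               (choose-⊆ (suc j ℕ.+ m) ys))
    sumC-++ Q (x ∷ xs) ys zero zero F _ _ _ = sym (+-identityʳ _)
    sumC-++ Q (x ∷ xs) ys zero (suc m) F (Qx ∷ xs-true) ys-false F≡0 = begin
        sumC (suc m) (x ∷ xs ++ ys) F
      ≡⟨ sumC-cons m x (xs ++ ys) F ⟩
        sumC m (xs ++ ys) (λ S → F (x ∷ S)) + sumC (suc m) (xs ++ ys) F
      ≡⟨ cong₂ _+_ (sumℚ-zero (choose m (xs ++ ys)) (All.tabulate (λ {S} _ → F≡0 (x ∷ S) (x∷S-contains-x S))))
                   (sumC-++ Q xs ys zero (suc m) F xs-true ys-false F≡0) ⟩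
        0ℚ + (sumC (suc m) ys F + 0ℚ)
      ≡⟨ +-identityˡ _ ⟩
        sumC (suc m) ys F + 0ℚ ∎
      where
      open ≡-Reasoning
      x∷S-contains-x : ∀ S → ¬ countB Q (x ∷ S) ≡ 0
      x∷S-contains-x S rewrite Qx = λ ()
    sumC-++ Q (x ∷ xs) ys (suc j) m F (Qx ∷ xs-true) ys-false F≡0 = begin
        sumC (suc (j ℕ.+ m)) (x ∷ xs ++ ys) F
      ≡⟨ sumC-cons (j ℕ.+ m) x (xs ++ ys) F ⟩
        sumC (j ℕ.+ m) (xs ++ ys) (λ S → F (x ∷ S)) + sumC (suc j ℕ.+ m) (xs ++ ys) F
      ≡⟨ cong₂ _+_ (sumC-++ Q xs ys j m (λ S → F (x ∷ S)) xs-true ys-false F[x∷S]≡0)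
                   (sumC-++ Q xs ys (suc j) m F xs-true ys-false F≡0) ⟩
        sumC j xs (λ S → sumC m ys (λ T → F (x ∷ S ++ T))) + sumC (suc j) xs (λ S → sumC m ys (λ T → F (S ++ T)))
      ≡⟨ sym (sumC-cons j x xs (λ S → sumC m ys (λ T → F (S ++ T)))) ⟩
        sumC (suc j) (x ∷ xs) (λ S → sumC m ys (λ T → F (S ++ T))) ∎
      where
      open ≡-Reasoning
      F[x∷S]≡0 : ∀ S → ¬ countB Q S ≡ j → F (x ∷ S) ≡ 0ℚ
      F[x∷S]≡0 S ≢j = F≡0 (x ∷ S) (λ e → ≢j (ℕₚ.suc-injective (trans (sym count-x∷S) e)))
        where
        count-x∷S : countB Q (x ∷ S) ≡ suc (countB Q S)
        count-x∷S rewrite Qx = refl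

  -- the sum of g (number of hits) over the k-subsets of h hits and l misses
  hitSum : ℕ → ℕ → ℕ → (ℕ → ℚ) → ℚ
  hitSum zero    h       l g = g 0
  hitSum (suc k) zero    l g = ℕtoℚ (l C suc k) * g 0
  hitSum (suc k) (suc h) l g = hitSum k h l (λ i → g (suc i)) + hitSum (suc k) h l g

  hitSum-no-hits : ∀ k l g → hitSum k 0 l g ≡ ℕtoℚ (l C k) * g 0
  hitSum-no-hits zero    l g = sym (*-identityˡ (g 0))
  hitSum-no-hits (suc k) l g = refl

  hitSum-suc-misses : ∀ k h l g → hitSum (suc k) h (suc l) g ≡ hitSum k h l g + hitSum (suc k) h l g
  hitSum-suc-misses k zero l g = begin
      ℕtoℚ (suc l C suc k) * g 0
    ≡⟨ cong (λ c → ℕtoℚ c * g 0) (sym (nCk+nC[k+1]≡[n+1]C[k+1] l k)) ⟩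
      ℕtoℚ (l C k ℕ.+ l C suc k) * g 0
    ≡⟨ trans (cong (_* g 0) (ℕtoℚ-+ (l C k) (l C suc k))) (*-distribʳ-+ (g 0) (ℕtoℚ (l C k)) _) ⟩
      ℕtoℚ (l C k) * g 0 + ℕtoℚ (l C suc k) * g 0
    ≡⟨ cong (_+ ℕtoℚ (l C suc k) * g 0) (sym (hitSum-no-hits k l g)) ⟩
      hitSum k 0 l g + ℕtoℚ (l C suc k) * g 0 ∎
    where open ≡-Reasoning
  hitSum-suc-misses zero (suc h) l g = begin
      g 1 + hitSum 1 h (suc l) g
    ≡⟨ cong (g 1 +_) (hitSum-suc-misses zero h l g) ⟩
      g 1 + (g 0 + hitSum 1 h l g)
    ≡⟨ solve 3 (λ a b c → a :+ (b :+ c) := b :+ (a :+ c)) refl (g 1) (g 0) (hitSum 1 h l g) ⟩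
      g 0 + (g 1 + hitSum 1 h l g) ∎
    where open ≡-Reasoning
  hitSum-suc-misses (suc k) (suc h) l g = begin
      hitSum (suc k) h (suc l) g′ + hitSum (suc (suc k)) h (suc l) g
    ≡⟨ cong₂ _+_ (hitSum-suc-misses k h l g′) (hitSum-suc-misses (suc k) h l g) ⟩
      (hitSum k h l g′ + hitSum (suc k) h l g′) + (hitSum (suc k) h l g + hitSum (suc (suc k)) h l g)
    ≡⟨ solve 4 (λ a b c d → (a :+ b) :+ (c :+ d) := (a :+ c) :+ (b :+ d)) refl
         (hitSum k h l g′) (hitSum (suc k) h l g′) (hitSum (suc k) h l g) (hitSum (suc (suc k)) h l g) ⟩
      (hitSum k h l g′ + hitSum (suc k) h l g) + (hitSum (suc k) h l g′ + hitSum (suc (suc k)) h l g) ∎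
    where
    open ≡-Reasoning
    g′ = λ i → g (suc i)

  sumC-hits : {A : Set} (hit : A → Bool) (k : ℕ) (ys : List A) (g : ℕ → ℚ) →
    sumC k ys (λ T → g (countB hit T)) ≡ hitSum k (countB hit ys) (countB (λ y → not (hit y)) ys) g
  sumC-hits hit zero    []       g = +-identityʳ (g 0)
  sumC-hits hit (suc k) []       g = sym (*-zeroˡ (g 0))
  sumC-hits hit zero    (y ∷ ys) g = +-identityʳ (g 0)
  sumC-hits hit (suc k) (y ∷ ys) g with hit y in hit-y
  ... | true  = trans (sumC-cons k y ys _) (cong₂ _+_
    (trans (sumC-cong k ys (λ S → cong g (count-∷ S))) (sumC-hits hit k ys (λ i → g (suc i))))
    (sumC-hits hit (suc k) ys g))
    where
    count-∷ : ∀ S → countB hit (y ∷ S) ≡ suc (countB hit S)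
    count-∷ S rewrite hit-y = refl
  ... | false = trans (sumC-cons k y ys _) (trans (cong₂ _+_
    (trans (sumC-cong k ys (λ S → cong g (count-∷ S))) (sumC-hits hit k ys g))
    (sumC-hits hit (suc k) ys g))
    (sym (hitSum-suc-misses k (countB hit ys) (countB (λ y → not (hit y)) ys) g)))
    where
    count-∷ : ∀ S → countB hit (y ∷ S) ≡ countB hit S
    count-∷ S rewrite hit-y = refl

  ℕtoℚ-C-suc : ∀ x k → ℕtoℚ (suc x C suc k) ≡ ℕtoℚ (x C k) + ℕtoℚ (x C suc k)
  ℕtoℚ-C-suc x k = trans (cong ℕtoℚ (sym (nCk+nC[k+1]≡[n+1]C[k+1] x k))) (ℕtoℚ-+ (x C k) (x C suc k))

  ℕtoℚ-C-1 : ∀ x → ℕtoℚ (x C 1) ≡ ℕtoℚ x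
  ℕtoℚ-C-1 x = cong ℕtoℚ (nC1≡n x)

  C₂ C₃ : ℚ → ℚ
  C₂ x = (ℤ.+ 1 / 2) * (x * x - x)
  C₃ x = (ℤ.+ 1 / 6) * (x * (x * x) - ℕtoℚ 3 * (x * x) + ℕtoℚ 2 * x)

  ℕtoℚ-C-2 : ∀ x → ℕtoℚ (x C 2) ≡ C₂ (ℕtoℚ x)
  ℕtoℚ-C-2 zero    = refl
  ℕtoℚ-C-2 (suc x) = begin
      ℕtoℚ (suc x C 2)
    ≡⟨ trans (ℕtoℚ-C-suc x 1) (cong₂ _+_ (ℕtoℚ-C-1 x) (ℕtoℚ-C-2 x)) ⟩
      X + (ℤ.+ 1 / 2) * (X * X - X)
    ≡⟨ solve 1 (λ X → X :+ con (ℤ.+ 1 / 2) :* (X :* X :- X)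
                   := con (ℤ.+ 1 / 2) :* ((con 1ℚ :+ X) :* (con 1ℚ :+ X) :- (con 1ℚ :+ X))) refl X ⟩
      (ℤ.+ 1 / 2) * ((1ℚ + X) * (1ℚ + X) - (1ℚ + X))
    ≡⟨ cong (λ Y → (ℤ.+ 1 / 2) * (Y * Y - Y)) (sym (ℕtoℚ-suc x)) ⟩
      (ℤ.+ 1 / 2) * (ℕtoℚ (suc x) * ℕtoℚ (suc x) - ℕtoℚ (suc x)) ∎
    where
    open ≡-Reasoning
    X = ℕtoℚ x

  ℕtoℚ-C-3 : ∀ x → ℕtoℚ (x C 3) ≡ C₃ (ℕtoℚ x)
  ℕtoℚ-C-3 zero    = refl
  ℕtoℚ-C-3 (suc x) = begin
      ℕtoℚ (suc x C 3)
    ≡⟨ trans (ℕtoℚ-C-suc x 2) (cong₂ _+_ (ℕtoℚ-C-2 x) (ℕtoℚ-C-3 x)) ⟩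
      (ℤ.+ 1 / 2) * (X * X - X) + (ℤ.+ 1 / 6) * (X * (X * X) - ℕtoℚ 3 * (X * X) + ℕtoℚ 2 * X)
    ≡⟨ solve 1 (λ X → con (ℤ.+ 1 / 2) :* (X :* X :- X)
                      :+ con (ℤ.+ 1 / 6) :* (X :* (X :* X) :- con (ℕtoℚ 3) :* (X :* X) :+ con (ℕtoℚ 2) :* X)
                   := con (ℤ.+ 1 / 6) :* (Y X :* (Y X :* Y X) :- con (ℕtoℚ 3) :* (Y X :* Y X) :+ con (ℕtoℚ 2) :* Y X)) refl X ⟩
      (ℤ.+ 1 / 6) * ((1ℚ + X) * ((1ℚ + X) * (1ℚ + X)) - ℕtoℚ 3 * ((1ℚ + X) * (1ℚ + X)) + ℕtoℚ 2 * (1ℚ + X))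
    ≡⟨ cong (λ Y → (ℤ.+ 1 / 6) * (Y * (Y * Y) - ℕtoℚ 3 * (Y * Y) + ℕtoℚ 2 * Y)) (sym (ℕtoℚ-suc x)) ⟩
      (ℤ.+ 1 / 6) * (ℕtoℚ (suc x) * (ℕtoℚ (suc x) * ℕtoℚ (suc x)) - ℕtoℚ 3 * (ℕtoℚ (suc x) * ℕtoℚ (suc x)) + ℕtoℚ 2 * ℕtoℚ (suc x)) ∎
    where
    open ≡-Reasoning
    X = ℕtoℚ x
    Y = λ X → con 1ℚ :+ X

  hitSum-1 : ∀ h l g → hitSum 1 h l g ≡ ℕtoℚ h * g 1 + ℕtoℚ l * g 0
  hitSum-1 zero    l g = trans (cong (_* g 0) (ℕtoℚ-C-1 l))
    (solve 3 (λ L a b → L :* b := con 0ℚ :* a :+ L :* b) refl (ℕtoℚ l) (g 1) (g 0))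
  hitSum-1 (suc h) l g = begin
      g 1 + hitSum 1 h l g                  ≡⟨ cong (g 1 +_) (hitSum-1 h l g) ⟩
      g 1 + (H * g 1 + L * g 0)             ≡⟨ solve 4 (λ H L a b → a :+ (H :* a :+ L :* b) := (con 1ℚ :+ H) :* a :+ L :* b) refl H L (g 1) (g 0) ⟩
      (1ℚ + H) * g 1 + L * g 0              ≡⟨ cong (λ x → x * g 1 + L * g 0) (sym (ℕtoℚ-suc h)) ⟩
      ℕtoℚ (suc h) * g 1 + L * g 0          ∎
    where
    open ≡-Reasoning
    H = ℕtoℚ h
    L = ℕtoℚ l

  hitSum-2 : ∀ h l g → hitSum 2 h l g ≡ ℕtoℚ (h C 2) * g 2 + ℕtoℚ h * ℕtoℚ l * g 1 + ℕtoℚ (l C 2) * g 0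
  hitSum-2 zero    l g = solve 5 (λ L L₂ a b c → L₂ :* c := con 0ℚ :* a :+ con 0ℚ :* L :* b :+ L₂ :* c) refl
    (ℕtoℚ l) (ℕtoℚ (l C 2)) (g 2) (g 1) (g 0)
  hitSum-2 (suc h) l g = begin
      hitSum 1 h l (λ i → g (suc i)) + hitSum 2 h l g
    ≡⟨ cong₂ _+_ (hitSum-1 h l (λ i → g (suc i))) (hitSum-2 h l g) ⟩
      (H * g 2 + L * g 1) + (H₂ * g 2 + H * L * g 1 + L₂ * g 0)
    ≡⟨ solve 7 (λ H L H₂ L₂ a b c → (H :* a :+ L :* b) :+ (H₂ :* a :+ H :* L :* b :+ L₂ :* c)
                                  := (H :+ H₂) :* a :+ (con 1ℚ :+ H) :* L :* b :+ L₂ :* c) refl H L H₂ L₂ (g 2) (g 1) (g 0) ⟩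
      (H + H₂) * g 2 + (1ℚ + H) * L * g 1 + L₂ * g 0
    ≡⟨ cong₂ (λ x y → x * g 2 + y * L * g 1 + L₂ * g 0)
         (sym (trans (ℕtoℚ-C-suc h 1) (cong (_+ H₂) (ℕtoℚ-C-1 h)))) (sym (ℕtoℚ-suc h)) ⟩
      ℕtoℚ (suc h C 2) * g 2 + ℕtoℚ (suc h) * L * g 1 + L₂ * g 0 ∎
    where
    open ≡-Reasoning
    H = ℕtoℚ h
    L = ℕtoℚ l
    H₂ = ℕtoℚ (h C 2)
    L₂ = ℕtoℚ (l C 2)

  hitSum-3 : ∀ h l g → hitSum 3 h l g
    ≡ ℕtoℚ (h C 3) * g 3 + ℕtoℚ (h C 2) * ℕtoℚ l * g 2 + ℕtoℚ h * ℕtoℚ (l C 2) * g 1 + ℕtoℚ (l C 3) * g 0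
  hitSum-3 zero    l g = solve 7 (λ L L₂ L₃ a b c d → L₃ :* d := con 0ℚ :* a :+ con 0ℚ :* L :* b :+ con 0ℚ :* L₂ :* c :+ L₃ :* d) refl
    (ℕtoℚ l) (ℕtoℚ (l C 2)) (ℕtoℚ (l C 3)) (g 3) (g 2) (g 1) (g 0)
  hitSum-3 (suc h) l g = begin
      hitSum 2 h l (λ i → g (suc i)) + hitSum 3 h l g
    ≡⟨ cong₂ _+_ (hitSum-2 h l (λ i → g (suc i))) (hitSum-3 h l g) ⟩
      (H₂ * g 3 + H * L * g 2 + L₂ * g 1) + (H₃ * g 3 + H₂ * L * g 2 + H * L₂ * g 1 + L₃ * g 0)
    ≡⟨ solve 10 (λ H L H₂ L₂ H₃ L₃ a b c d →
           (H₂ :* a :+ H :* L :* b :+ L₂ :* c) :+ (H₃ :* a :+ H₂ :* L :* b :+ H :* L₂ :* c :+ L₃ :* d)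
        := (H₂ :+ H₃) :* a :+ (H :+ H₂) :* L :* b :+ (con 1ℚ :+ H) :* L₂ :* c :+ L₃ :* d) refl
        H L H₂ L₂ H₃ L₃ (g 3) (g 2) (g 1) (g 0) ⟩
      (H₂ + H₃) * g 3 + (H + H₂) * L * g 2 + (1ℚ + H) * L₂ * g 1 + L₃ * g 0
    ≡⟨ cong₂ (λ x y → x * g 3 + y * L * g 2 + (1ℚ + H) * L₂ * g 1 + L₃ * g 0)
         (sym (ℕtoℚ-C-suc h 2)) (sym (trans (ℕtoℚ-C-suc h 1) (cong (_+ H₂) (ℕtoℚ-C-1 h)))) ⟩
      ℕtoℚ (suc h C 3) * g 3 + ℕtoℚ (suc h C 2) * L * g 2 + (1ℚ + H) * L₂ * g 1 + L₃ * g 0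
    ≡⟨ cong (λ x → ℕtoℚ (suc h C 3) * g 3 + ℕtoℚ (suc h C 2) * L * g 2 + x * L₂ * g 1 + L₃ * g 0) (sym (ℕtoℚ-suc h)) ⟩
      ℕtoℚ (suc h C 3) * g 3 + ℕtoℚ (suc h C 2) * L * g 2 + ℕtoℚ (suc h) * L₂ * g 1 + L₃ * g 0 ∎
    where
    open ≡-Reasoning
    H = ℕtoℚ h
    L = ℕtoℚ l
    H₂ = ℕtoℚ (h C 2)
    L₂ = ℕtoℚ (l C 2)
    H₃ = ℕtoℚ (h C 3)
    L₃ = ℕtoℚ (l C 3)

  paperRHS : ℚ → ℚ → ℚ → ℚ → ℚ → ℚ
  paperRHS N g₀ g₁ g₂ g₃ =
    let c = λ (m : ℕ) → ℕtoℚ m in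
        (ℤ.+ 1 / 6) * (N ^ℚ 8 - c 7 * N ^ℚ 7 + c 21 * N ^ℚ 6 - c 35 * N ^ℚ 5 + c 34 * N ^ℚ 4 - c 18 * N ^ℚ 3 + c 4 * N ^ℚ 2) * g₀
      + (ℤ.+ 1 / 2) * (N ^ℚ 7 - c 7 * N ^ℚ 6 + c 21 * N ^ℚ 5 - c 35 * N ^ℚ 4 + c 34 * N ^ℚ 3 - c 18 * N ^ℚ 2 + c 4 * N) * g₁
      + (ℤ.+ 1 / 2) * (N ^ℚ 6 - c 8 * N ^ℚ 5 + c 25 * N ^ℚ 4 - c 40 * N ^ℚ 3 + c 34 * N ^ℚ 2 - c 12 * N) * g₂
      + (ℤ.+ 1 / 6) * (N ^ℚ 5 - c 10 * N ^ℚ 4 + c 35 * N ^ℚ 3 - c 50 * N ^ℚ 2 + c 24 * N) * g₃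

  total≡paperRHS-polynomial : ∀ M {A H H₂ H₃ L L₂ L₃ : ℚ} g₀ g₁ g₂ g₃ →
    A ≡ (ℕtoℚ 4 + M) * (ℕtoℚ 3 + M) → H₃ ≡ C₃ H → H₂ ≡ C₂ H → H ≡ ℕtoℚ 2 + M →
    L₂ ≡ C₂ L → L₃ ≡ C₃ L → L ≡ M * M + ℕtoℚ 6 * M + ℕtoℚ 10 →
    A * (H₃ * g₃ + H₂ * L * g₂ + H * L₂ * g₁ + L₃ * g₀) ≡ paperRHS (ℕtoℚ 4 + M) g₀ g₁ g₂ g₃
  total≡paperRHS-polynomial M g₀ g₁ g₂ g₃ refl refl refl refl refl refl refl = solve 5 (λ M g₀ g₁ g₂ g₃ →
      let N  = con (ℕtoℚ 4) :+ M
          H  = con (ℕtoℚ 2) :+ M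
          L  = M :* M :+ con (ℕtoℚ 6) :* M :+ con (ℕtoℚ 10)
          c₂ = λ x → con (ℤ.+ 1 / 2) :* (x :* x :- x)
          c₃ = λ x → con (ℤ.+ 1 / 6) :* (x :* (x :* x) :- con (ℕtoℚ 3) :* (x :* x) :+ con (ℕtoℚ 2) :* x)
      in (N :* (con (ℕtoℚ 3) :+ M)) :* (c₃ H :* g₃ :+ c₂ H :* L :* g₂ :+ H :* c₂ L :* g₁ :+ c₃ L :* g₀)
      := con (ℤ.+ 1 / 6) :* (N :^ 8 :- con (ℕtoℚ 7) :* N :^ 7 :+ con (ℕtoℚ 21) :* N :^ 6 :- con (ℕtoℚ 35) :* N :^ 5 :+ con (ℕtoℚ 34) :* N :^ 4 :- con (ℕtoℚ 18) :* N :^ 3 :+ con (ℕtoℚ 4) :* N :^ 2) :* g₀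
      :+ con (ℤ.+ 1 / 2) :* (N :^ 7 :- con (ℕtoℚ 7) :* N :^ 6 :+ con (ℕtoℚ 21) :* N :^ 5 :- con (ℕtoℚ 35) :* N :^ 4 :+ con (ℕtoℚ 34) :* N :^ 3 :- con (ℕtoℚ 18) :* N :^ 2 :+ con (ℕtoℚ 4) :* N) :* g₁
      :+ con (ℤ.+ 1 / 2) :* (N :^ 6 :- con (ℕtoℚ 8) :* N :^ 5 :+ con (ℕtoℚ 25) :* N :^ 4 :- con (ℕtoℚ 40) :* N :^ 3 :+ con (ℕtoℚ 34) :* N :^ 2 :- con (ℕtoℚ 12) :* N) :* g₂
      :+ con (ℤ.+ 1 / 6) :* (N :^ 5 :- con (ℕtoℚ 10) :* N :^ 4 :+ con (ℕtoℚ 35) :* N :^ 3 :- con (ℕtoℚ 50) :* N :^ 2 :+ con (ℕtoℚ 24) :* N) :* g₃)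
    refl M g₀ g₁ g₂ g₃

  isForm : ∀ {n} → Form → Sub n → Bool
  isForm f s = formIs f (proj₁ s)

  ≢⇒≡ᵇ-false : ∀ {a b : ℕ} → ¬ a ≡ b → (a ℕ.≡ᵇ b) ≡ false
  ≢⇒≡ᵇ-false {a} {b} a≢b with a ℕ.≡ᵇ b in eq
  ... | true  = ⊥-elim (a≢b (ℕₚ.≡ᵇ⇒≡ a b (subst T (sym eq) _)))
  ... | false = refl

  module Counting {n : ℕ} (3≤n : 3 ℕ.≤ n) (p : ℚ) where

    term : ℕ → ℕ → ℕ → List (Sub n) → ℚ
    term i j k S = if hasType i j k S then p ^ℚ unionSize S else 0ℚ

    term-prefix : ∀ {i j k} S → ¬ countB (isForm prefix) S ≡ i → term i j k S ≡ 0ℚ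
    term-prefix {i} {j} {k} S ≢i =
      cong (λ b → if b ∧ ((countForm middle S ℕ.≡ᵇ j) ∧ (countForm suffix S ℕ.≡ᵇ k)) then p ^ℚ unionSize S else 0ℚ)
           (≢⇒≡ᵇ-false ≢i)

    term-middle : ∀ {i j k} S → ¬ countB (isForm middle) S ≡ j → term i j k S ≡ 0ℚ
    term-middle {i} {j} {k} S ≢j = trans
      (cong (λ b → if (countForm prefix S ℕ.≡ᵇ i) ∧ (b ∧ (countForm suffix S ℕ.≡ᵇ k)) then p ^ℚ unionSize S else 0ℚ)
            (≢⇒≡ᵇ-false ≢j))
      (cong (λ b → if b then p ^ℚ unionSize S else 0ℚ) (Boolₚ.∧-zeroʳ (countForm prefix S ℕ.≡ᵇ i)))

    Ps Ms Ss : List (Sub n)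
    Ps = subnetworks prefix
    Ms = subnetworks middle
    Ss = subnetworks suffix

    Pijk-sumC : ∀ i j k → Pijk n p i j k ≡ sumC 4 (Ps ++ (Ms ++ Ss)) (term i j k)
    Pijk-sumC i j k = trans (sumℚ-filterᵇ (hasType i j k) (λ S → p ^ℚ unionSize S) (choose 4 (allSubs n)))
      (cong (λ Ss′ → sumC 4 (Ps ++ (Ms ++ Ss′)) (term i j k)) (Listₚ.++-identityʳ Ss))

    form-of : ∀ f g → All (λ s → isForm f s ≡ formIs f g) (subnetworks {n} g)
    form-of f g = All.map (λ { (isSub _) → refl }) (subnetworks-IsSub g)

    Triple : Form → List (Sub n) → Set
    Triple f U = length U ≡ 3 × All (IsSub f) U × AllPairs (λ s t → ¬ s ≡ t) U

    triples : ∀ f → All (Triple f) (choose 3 (subnetworks f))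
    triples f = All.zipWith (λ (|U|≡3 , U⊆) → |U|≡3 , All-resp-⊆ U⊆ (subnetworks-IsSub f) , AllPairs-resp-⊆ U⊆ (subnetworks-distinct f))
      (choose-length 3 (subnetworks f) , choose-⊆ 3 (subnetworks f))

    weight : ℕ → ℚ
    weight t = p ^ℚ (4 ℕ.* (n ℕ.∸ 2) ! ℕ.∸ t ℕ.* (n ℕ.∸ 3) !)

    misses : ℕ
    misses = n ℕ.* (n ℕ.∸ 1) ℕ.∸ (n ℕ.∸ 2)

    tripleSum : ℚ
    tripleSum = hitSum 3 (n ℕ.∸ 2) misses weight

    sumC-triples : ∀ f (meets : Sub n → Bool) (H : List (Sub n) → ℚ) → countB meets (subnetworks f) ≡ n ℕ.∸ 2 →
      (∀ {s₁ s₂ s₃} → IsSub f s₁ → IsSub f s₂ → IsSub f s₃ → ¬ s₁ ≡ s₂ → ¬ s₁ ≡ s₃ → ¬ s₂ ≡ s₃ →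
         H (s₁ ∷ s₂ ∷ s₃ ∷ []) ≡ weight (countB meets (s₁ ∷ s₂ ∷ s₃ ∷ []))) →
      sumC 3 (subnetworks f) H ≡ tripleSum
    sumC-triples f meets H hits H≡weight = begin
        sumC 3 Ys H
      ≡⟨ sumℚ-cong-All (choose 3 Ys) (All.map at-triple (triples f)) ⟩
        sumC 3 Ys (λ U → weight (countB meets U))
      ≡⟨ sumC-hits meets 3 Ys weight ⟩
        hitSum 3 (countB meets Ys) (countB (λ y → not (meets y)) Ys) weight
      ≡⟨ cong₂ (λ h l → hitSum 3 h l weight) hits non-hits ⟩
        tripleSum ∎
      where
      open ≡-Reasoning
      Ys = subnetworks f
      at-triple : ∀ {U} → Triple f U → H U ≡ weight (countB meets U)
      at-triple {_ ∷ _ ∷ _ ∷ []} (refl , i₁ ∷ i₂ ∷ i₃ ∷ [] , (d₁₂ ∷ d₁₃ ∷ []) ∷ (d₂₃ ∷ []) ∷ [] ∷ []) = H≡weight i₁ i₂ i₃ d₁₂ d₁₃ d₂₃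
      non-hits : countB (λ y → not (meets y)) Ys ≡ misses
      non-hits = begin
          countB (λ y → not (meets y)) Ys
        ≡⟨ sym (ℕₚ.m+n∸m≡n (countB meets Ys) _) ⟩
          countB meets Ys ℕ.+ countB (λ y → not (meets y)) Ys ℕ.∸ countB meets Ys
        ≡⟨ cong₂ ℕ._∸_ (trans (countB-+-not meets Ys) (length-subnetworks {n} f)) hits ⟩
          misses ∎

    total : ℚ
    total = ℕtoℚ (n ℕ.* (n ℕ.∸ 1)) * tripleSum

    2≤n : 2 ℕ.≤ n
    2≤n = ℕₚ.≤-trans (ℕₚ.n≤1+n 2) 3≤n

    sumℚ-subnetworks : ∀ f (F : Sub n → ℚ) → All (λ s → F s ≡ tripleSum) (subnetworks f) → sumℚ (map F (subnetworks f)) ≡ total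
    sumℚ-subnetworks f F F≡tripleSum = trans (sumℚ-const tripleSum (subnetworks f) F≡tripleSum) (cong (λ k → ℕtoℚ k * tripleSum) (length-subnetworks {n} f))

    P013 : Pijk n p 0 1 3 ≡ total
    P013 = begin
        Pijk n p 0 1 3
      ≡⟨ Pijk-sumC 0 1 3 ⟩
        sumC 4 (Ps ++ (Ms ++ Ss)) F
      ≡⟨ sumC-++ (isForm prefix) Ps (Ms ++ Ss) 0 4 F (form-of prefix prefix)
           (Allₚ.++⁺ (form-of prefix middle) (form-of prefix suffix)) term-prefix ⟩
        sumC 4 (Ms ++ Ss) F + 0ℚ
      ≡⟨ +-identityʳ _ ⟩
        sumC 4 (Ms ++ Ss) F
      ≡⟨ sumC-++ (isForm middle) Ms Ss 1 3 F (form-of middle middle) (form-of middle suffix) term-middle ⟩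
        sumC 1 Ms (λ S → sumC 3 Ss (λ U → F (S ++ U)))
      ≡⟨ sumC-1 Ms _ ⟩
        sumℚ (map (λ x → sumC 3 Ss (λ U → F (x ∷ U))) Ms)
      ≡⟨ sumℚ-subnetworks middle _ (All.map per-middle (subnetworks-IsSub middle)) ⟩
        total ∎
      where
      open ≡-Reasoning
      F = term 0 1 3
      star : ∀ {b₁ b₂} → ¬ b₁ ≡ b₂ → ∀ {s₁ s₂ s₃} → IsSub suffix s₁ → IsSub suffix s₂ → IsSub suffix s₃ →
        ¬ s₁ ≡ s₂ → ¬ s₁ ≡ s₃ → ¬ s₂ ≡ s₃ →
        F ((middle , b₁ , b₂) ∷ s₁ ∷ s₂ ∷ s₃ ∷ []) ≡ weight (countB (λ t → meetsMS b₁ b₂ (letter₁ t) (letter₂ t)) (s₁ ∷ s₂ ∷ s₃ ∷ []))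
      star {b₁} {b₂} b≢ {s₁} {s₂} {s₃} (isSub a≢) (isSub a′≢) (isSub a″≢) d₁₂ d₁₃ d₂₃ = cong (p ^ℚ_) (unionSize-star
        ((n ℕ.∸ 2) !) ((n ℕ.∸ 3) !) (λ t → meetsMS b₁ b₂ (letter₁ t) (letter₂ t)) (middle , b₁ , b₂) s₁ s₂ s₃
        (countB-inSub middle b≢ 2≤n ∷ countB-inSub suffix a≢ 2≤n ∷ countB-inSub suffix a′≢ 2≤n ∷ countB-inSub suffix a″≢ 2≤n ∷ [])
        (countB-middle-suffix b≢ a≢ 3≤n ∷ countB-middle-suffix b≢ a′≢ 3≤n ∷ countB-middle-suffix b≢ a″≢ 3≤n ∷ [])
        (suffix-disjoint d₁₂) (suffix-disjoint d₁₃) (suffix-disjoint d₂₃))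
      per-middle : ∀ {x} → IsSub middle x → sumC 3 Ss (λ U → F (x ∷ U)) ≡ tripleSum
      per-middle (isSub b≢) = sumC-triples suffix _ _ (countB-meets-last suffix b≢) (star b≢)

    P130 : Pijk n p 1 3 0 ≡ total
    P130 = begin
        Pijk n p 1 3 0
      ≡⟨ Pijk-sumC 1 3 0 ⟩
        sumC 4 (Ps ++ (Ms ++ Ss)) F
      ≡⟨ sumC-++ (isForm prefix) Ps (Ms ++ Ss) 1 3 F (form-of prefix prefix)
           (Allₚ.++⁺ (form-of prefix middle) (form-of prefix suffix)) term-prefix ⟩
        sumC 1 Ps (λ S → sumC 3 (Ms ++ Ss) (λ U → F (S ++ U)))
      ≡⟨ sumC-1 Ps _ ⟩
        sumℚ (map (λ x → sumC 3 (Ms ++ Ss) (λ U → F (x ∷ U))) Ps)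
      ≡⟨ sumℚ-subnetworks prefix _ (All.map per-prefix (subnetworks-IsSub prefix)) ⟩
        total ∎
      where
      open ≡-Reasoning
      F = term 1 3 0
      star : ∀ {a₁ a₂} → ¬ a₁ ≡ a₂ → ∀ {s₁ s₂ s₃} → IsSub middle s₁ → IsSub middle s₂ → IsSub middle s₃ →
        ¬ s₁ ≡ s₂ → ¬ s₁ ≡ s₃ → ¬ s₂ ≡ s₃ →
        sumC 0 Ss (λ U → F ((prefix , a₁ , a₂) ∷ (s₁ ∷ s₂ ∷ s₃ ∷ []) ++ U))
          ≡ weight (countB (λ t → meetsPM a₁ a₂ (letter₁ t) (letter₂ t)) (s₁ ∷ s₂ ∷ s₃ ∷ []))
      star {a₁} {a₂} a≢ {s₁} {s₂} {s₃} (isSub b≢) (isSub b′≢) (isSub b″≢) d₁₂ d₁₃ d₂₃ = trans (+-identityʳ _) (cong (p ^ℚ_) (unionSize-star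
        ((n ℕ.∸ 2) !) ((n ℕ.∸ 3) !) (λ t → meetsPM a₁ a₂ (letter₁ t) (letter₂ t)) (prefix , a₁ , a₂) s₁ s₂ s₃
        (countB-inSub prefix a≢ 2≤n ∷ countB-inSub middle b≢ 2≤n ∷ countB-inSub middle b′≢ 2≤n ∷ countB-inSub middle b″≢ 2≤n ∷ [])
        (countB-prefix-middle a≢ b≢ 3≤n ∷ countB-prefix-middle a≢ b′≢ 3≤n ∷ countB-prefix-middle a≢ b″≢ 3≤n ∷ [])
        (middle-disjoint d₁₂) (middle-disjoint d₁₃) (middle-disjoint d₂₃)))
      per-prefix : ∀ {x} → IsSub prefix x → sumC 3 (Ms ++ Ss) (λ U → F (x ∷ U)) ≡ tripleSum
      per-prefix {x} (isSub a≢) = trans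
        (sumC-++ (isForm middle) Ms Ss 3 0 (λ U → F (x ∷ U)) (form-of middle middle) (form-of middle suffix) (λ U → term-middle {1} {3} {0} (x ∷ U)))
        (sumC-triples middle _ _ (countB-meets-first middle a≢) (star a≢))

    P031 : Pijk n p 0 3 1 ≡ total
    P031 = begin
        Pijk n p 0 3 1
      ≡⟨ Pijk-sumC 0 3 1 ⟩
        sumC 4 (Ps ++ (Ms ++ Ss)) F
      ≡⟨ sumC-++ (isForm prefix) Ps (Ms ++ Ss) 0 4 F (form-of prefix prefix)
           (Allₚ.++⁺ (form-of prefix middle) (form-of prefix suffix)) term-prefix ⟩
        sumC 4 (Ms ++ Ss) F + 0ℚ
      ≡⟨ +-identityʳ _ ⟩
        sumC 4 (Ms ++ Ss) F
      ≡⟨ sumC-++ (isForm middle) Ms Ss 3 1 F (form-of middle middle) (form-of middle suffix) term-middle ⟩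
        sumC 3 Ms (λ S → sumC 1 Ss (λ U → F (S ++ U)))
      ≡⟨ sumC-cong 3 Ms (λ S → sumC-1 Ss (λ U → F (S ++ U))) ⟩
        sumℚ (map (λ S → sumℚ (map (λ y → F (S ++ y ∷ [])) Ss)) (choose 3 Ms))
      ≡⟨ sumℚ-swap (λ S y → F (S ++ y ∷ [])) (choose 3 Ms) Ss ⟩
        sumℚ (map (λ y → sumC 3 Ms (λ S → F (S ++ y ∷ []))) Ss)
      ≡⟨ sumℚ-subnetworks suffix _ (All.map per-suffix (subnetworks-IsSub suffix)) ⟩
        total ∎
      where
      open ≡-Reasoning
      F = term 0 3 1
      star : ∀ {a₁ a₂} → ¬ a₁ ≡ a₂ → ∀ {s₁ s₂ s₃} → IsSub middle s₁ → IsSub middle s₂ → IsSub middle s₃ →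
        ¬ s₁ ≡ s₂ → ¬ s₁ ≡ s₃ → ¬ s₂ ≡ s₃ →
        F ((s₁ ∷ s₂ ∷ s₃ ∷ []) ++ (suffix , a₁ , a₂) ∷ [])
          ≡ weight (countB (λ t → meetsMS (letter₁ t) (letter₂ t) a₁ a₂) (s₁ ∷ s₂ ∷ s₃ ∷ []))
      star {a₁} {a₂} a≢ {s₁} {s₂} {s₃} (isSub b≢) (isSub b′≢) (isSub b″≢) d₁₂ d₁₃ d₂₃ =
        cong (p ^ℚ_) (trans (unionSize-rotate (suffix , a₁ , a₂) s₁ s₂ s₃) (unionSize-star
          ((n ℕ.∸ 2) !) ((n ℕ.∸ 3) !) (λ t → meetsMS (letter₁ t) (letter₂ t) a₁ a₂) (suffix , a₁ , a₂) s₁ s₂ s₃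
          (countB-inSub suffix a≢ 2≤n ∷ countB-inSub middle b≢ 2≤n ∷ countB-inSub middle b′≢ 2≤n ∷ countB-inSub middle b″≢ 2≤n ∷ [])
          (suffix-middle b≢ ∷ suffix-middle b′≢ ∷ suffix-middle b″≢ ∷ [])
          (middle-disjoint d₁₂) (middle-disjoint d₁₃) (middle-disjoint d₂₃)))
        where
        suffix-middle : ∀ {b₁ b₂} → ¬ b₁ ≡ b₂ →
          countB (λ u → inSub (suffix , a₁ , a₂) u ∧ inSub (middle , b₁ , b₂) u) (vertices n)
            ≡ (if meetsMS b₁ b₂ a₁ a₂ then (n ℕ.∸ 3) ! else 0)
        suffix-middle b≢ = trans (countB-cong (vertices n) (λ u → Boolₚ.∧-comm (inSub (suffix , a₁ , a₂) u) _))
                                 (countB-middle-suffix b≢ a≢ 3≤n)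
      per-suffix : ∀ {y} → IsSub suffix y → sumC 3 Ms (λ S → F (S ++ y ∷ [])) ≡ tripleSum
      per-suffix (isSub {a₁} {a₂} a≢) = sumC-triples middle _ _
        (trans (countB-cong Ms (λ t → cong₂ (λ x y → x ∧ not y) (eqFin-sym a₂ (letter₂ t)) (eqFin-sym (letter₁ t) a₁)))
               (countB-meets-last middle a≢))
        (star a≢)

  total-closed-form : ∀ m (p : ℚ) →
    let n  = 4 ℕ.+ m
        e₀ = 4 ℕ.* (n ℕ.∸ 2) !
        f  = (n ℕ.∸ 3) !
    in Counting.total {n} (ℕ.s≤s (ℕ.s≤s (ℕ.s≤s ℕ.z≤n))) p
       ≡ paperRHS (ℕtoℚ n) (p ^ℚ e₀) (p ^ℚ (e₀ ℕ.∸ f)) (p ^ℚ (e₀ ℕ.∸ 2 ℕ.* f)) (p ^ℚ (e₀ ℕ.∸ 3 ℕ.* f))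
  total-closed-form m p = begin
      ℕtoℚ (n ℕ.* (n ℕ.∸ 1)) * hitSum 3 (2 ℕ.+ m) misses weight
    ≡⟨ cong (ℕtoℚ (n ℕ.* (n ℕ.∸ 1)) *_) (hitSum-3 (2 ℕ.+ m) misses weight) ⟩
      ℕtoℚ (n ℕ.* (n ℕ.∸ 1)) * (ℕtoℚ ((2 ℕ.+ m) C 3) * weight 3 + ℕtoℚ ((2 ℕ.+ m) C 2) * ℕtoℚ misses * weight 2
                                + ℕtoℚ (2 ℕ.+ m) * ℕtoℚ (misses C 2) * weight 1 + ℕtoℚ (misses C 3) * weight 0)
    ≡⟨ total≡paperRHS-polynomial (ℕtoℚ m) (weight 0) (weight 1) (weight 2) (weight 3)
         (trans (ℕtoℚ-* (4 ℕ.+ m) (3 ℕ.+ m)) (cong₂ _*_ (ℕtoℚ-+ 4 m) (ℕtoℚ-+ 3 m)))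
         (ℕtoℚ-C-3 (2 ℕ.+ m)) (ℕtoℚ-C-2 (2 ℕ.+ m)) (ℕtoℚ-+ 2 m) (ℕtoℚ-C-2 misses) (ℕtoℚ-C-3 misses)
         (trans (cong ℕtoℚ (misses-polynomial m)) (trans (ℕtoℚ-+ (m ℕ.* m ℕ.+ 6 ℕ.* m) 10)
           (cong (_+ ℕtoℚ 10) (trans (ℕtoℚ-+ (m ℕ.* m) (6 ℕ.* m)) (cong₂ _+_ (ℕtoℚ-* m m) (ℕtoℚ-* 6 m)))))) ⟩
      paperRHS (ℕtoℚ 4 + ℕtoℚ m) (weight 0) (weight 1) (weight 2) (weight 3)
    ≡⟨ cong₂ (λ N g₁ → paperRHS N (weight 0) g₁ (weight 2) (weight 3)) (sym (ℕtoℚ-+ 4 m)) (cong (λ k → p ^ℚ (e₀ ℕ.∸ k)) (ℕₚ.+-identityʳ f)) ⟩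
      paperRHS (ℕtoℚ n) (p ^ℚ e₀) (p ^ℚ (e₀ ℕ.∸ f)) (p ^ℚ (e₀ ℕ.∸ 2 ℕ.* f)) (p ^ℚ (e₀ ℕ.∸ 3 ℕ.* f)) ∎
    where
    open ≡-Reasoning
    n  = 4 ℕ.+ m
    e₀ = 4 ℕ.* (n ℕ.∸ 2) !
    f  = (n ℕ.∸ 3) !
    open Counting {n} (ℕ.s≤s (ℕ.s≤s (ℕ.s≤s ℕ.z≤n))) p using (weight; misses)

open import Data.Nat using (_≥_; _∸_; _!)
open import Data.Nat as ℕ using ()
open import Data.Integer using (+_)
open import Data.Rational using (ℚ; _/_; _+_; _-_; _*_; _≤_; 0ℚ; 1ℚ)

theorem3 : (n : ℕ) → n ≥ 4 → (p : ℚ) → 0ℚ ≤ p → p ≤ 1ℚ →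
    let N = ℕtoℚ n
        c = λ (m : ℕ) → ℕtoℚ m
        e₀ = 4 ℕ.* ((n ∸ 2) !)
        f = (n ∸ 3) !
        rhs = (+ 1 / 6) * (N ^ℚ 8 - c 7 * N ^ℚ 7 + c 21 * N ^ℚ 6 - c 35 * N ^ℚ 5 + c 34 * N ^ℚ 4 - c 18 * N ^ℚ 3 + c 4 * N ^ℚ 2) * p ^ℚ e₀
            + (+ 1 / 2) * (N ^ℚ 7 - c 7 * N ^ℚ 6 + c 21 * N ^ℚ 5 - c 35 * N ^ℚ 4 + c 34 * N ^ℚ 3 - c 18 * N ^ℚ 2 + c 4 * N) * p ^ℚ (e₀ ∸ f)
            + (+ 1 / 2) * (N ^ℚ 6 - c 8 * N ^ℚ 5 + c 25 * N ^ℚ 4 - c 40 * N ^ℚ 3 + c 34 * N ^ℚ 2 - c 12 * N) * p ^ℚ (e₀ ∸ 2 ℕ.* f)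
            + (+ 1 / 6) * (N ^ℚ 5 - c 10 * N ^ℚ 4 + c 35 * N ^ℚ 3 - c 50 * N ^ℚ 2 + c 24 * N) * p ^ℚ (e₀ ∸ 3 ℕ.* f)
    in (Pijk n p 1 3 0 ≡ Pijk n p 0 3 1) × (Pijk n p 0 3 1 ≡ Pijk n p 0 1 3) × (Pijk n p 0 1 3 ≡ rhs)
theorem3 (ℕ.suc (ℕ.suc (ℕ.suc (ℕ.suc m)))) (ℕ.s≤s (ℕ.s≤s (ℕ.s≤s (ℕ.s≤s ℕ.z≤n)))) p _ _ =
  trans P130 (sym P031) , trans P031 (sym P013) , trans P013 (total-closed-form m p)
  where open Counting {4 ℕ.+ m} (ℕ.s≤s (ℕ.s≤s (ℕ.s≤s ℕ.z≤n))) p using (P130; P031; P013)
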